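{- Given any $\Sigma^0_2$ set $U$ of finite binary strings, there exists an oracle machine $M$ such that for every $X\in 2^\omega$ the following are equivalent: $M(X)$ is total; $M(X)$ has infinite domain; $X$ has no prefix in $U$.
   Context: For an oracle machine $M$ and $X\in2^\omega$, $M(X)$ is the partial function $n\mapsto M(X,n)$ from $\mathbb{N}$ to $\mathbb{N}$. A set of strings is $\Sigma^0_2$ if it is definable by a $\Sigma^0_2$ formula of arithmetic (equivalently, c.e. relative to $\emptyset'$). -}

module Defs where

open import Data.Nat using (ℕ; zero; suc; _+_; _*_; _<_; _≤_; _≡ᵇ_)
open import Data.Nat.Properties using ()
open import Data.Bool using (Bool; true; false; if_then_else_)
open import Data.List using (List; []; _∷_)
open import Data.Vec using (Vec; []; _∷_; lookup; _++_)
open import Data.Fin using (Fin)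
open import Data.Maybe using (Maybe; just; nothing)
open import Data.Product using (Σ; ∃; _×_; _,_; proj₁; proj₂)
open import Data.Sum using (_⊎_)
open import Data.Empty using (⊥)
open import Relation.Nullary using (¬_)
open import Relation.Binary.PropositionalEquality using (_≡_)
open import Function.Bundles using (_⇔_)

Cantor : Set
Cantor = ℕ → Bool

Str : Set
Str = List Bool

_↾_ : Cantor → ℕ → Str
X ↾ zero  = []
X ↾ suc n = X 0 ∷ ((λ i → X (suc i)) ↾ n)

HasPrefixIn : Cantor → (Str → Set) → Set
HasPrefixIn X U = ∃ λ n → U (X ↾ n)

-- Oracle machines: oracle register (Minsky) machines.
--   inc r      : R[r] := R[r] + 1, go to next instruction
--   decjz r j  : if R[r] = 0 then go to instruction j
--                else R[r] := R[r] - 1 and go to next instruction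
--   orc r      : R[r] := X(R[r]) (1 if true, 0 if false), go to next
-- The machine halts when the program counter leaves the program.
-- Input n is placed in register 0 (all others 0); output is register 0.

data Instr : Set where
  inc   : ℕ → Instr
  decjz : ℕ → ℕ → Instr
  orc   : ℕ → Instr

OracleMachine : Set
OracleMachine = List Instr

nth : {A : Set} → List A → ℕ → Maybe A
nth []       _       = nothing
nth (x ∷ xs) zero    = just x
nth (x ∷ xs) (suc i) = nth xs i

Regs : Set
Regs = ℕ → ℕ

set : Regs → ℕ → ℕ → Regs
set R r v i = if i ≡ᵇ r then v else R i

record Config : Set where
  constructor cfg
  field
    pc   : ℕ
    regs : Regs
open Config public

bit : Bool → ℕ
bit true  = 1
bit false = 0

exec : Cantor → Instr → Config → Config
exec X (inc r)     (cfg p R) = cfg (suc p) (set R r (suc (R r)))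
exec X (decjz r j) (cfg p R) with R r
... | zero  = cfg j R
... | suc v = cfg (suc p) (set R r v)
exec X (orc r)     (cfg p R) = cfg (suc p) (set R r (bit (X (R r))))

step : OracleMachine → Cantor → Config → Config
step M X c with nth M (pc c)
... | nothing = c
... | just ι  = exec X ι c

run : OracleMachine → Cantor → ℕ → Config → Config
run M X zero    c = c
run M X (suc k) c = run M X k (step M X c)

Halted : OracleMachine → Config → Set
Halted M c = nth M (pc c) ≡ nothing

initial : ℕ → Config
initial n = cfg 0 (λ r → if r ≡ᵇ 0 then n else 0)

Computes : OracleMachine → Cantor → ℕ → ℕ → Set
Computes M X n m =
  ∃ λ k → Halted M (run M X k (initial n)) × regs (run M X k (initial n)) 0 ≡ m

Converges : OracleMachine → Cantor → ℕ → Set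
Converges M X n = ∃ λ m → Computes M X n m

Total : OracleMachine → Cantor → Set
Total M X = (n : ℕ) → Converges M X n

InfiniteDomain : OracleMachine → Cantor → Set
InfiniteDomain M X = (N : ℕ) → ∃ λ n → N ≤ n × Converges M X n

data Term (n : ℕ) : Set where
  var  : Fin n → Term n
  zer  : Term n
  sc   : Term n → Term n
  _⊕_  : Term n → Term n → Term n
  _⊗_  : Term n → Term n → Term n

⟦_⟧t : {n : ℕ} → Term n → Vec ℕ n → ℕ
⟦ var i ⟧t ρ = lookup ρ i
⟦ zer ⟧t   ρ = 0
⟦ sc t ⟧t  ρ = suc (⟦ t ⟧t ρ)
⟦ s ⊕ t ⟧t ρ = ⟦ s ⟧t ρ + ⟦ t ⟧t ρ
⟦ s ⊗ t ⟧t ρ = ⟦ s ⟧t ρ * ⟦ t ⟧t ρ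

-- Bounded formulas; bound variable is variable 0 of the extended context.
data Δ₀ (n : ℕ) : Set where
  _≐_  : Term n → Term n → Δ₀ n
  _≺_  : Term n → Term n → Δ₀ n
  ¬'_  : Δ₀ n → Δ₀ n
  _∧'_ : Δ₀ n → Δ₀ n → Δ₀ n
  _∨'_ : Δ₀ n → Δ₀ n → Δ₀ n
  ∀<   : Term n → Δ₀ (suc n) → Δ₀ n
  ∃<   : Term n → Δ₀ (suc n) → Δ₀ n

⟦_⟧ : {n : ℕ} → Δ₀ n → Vec ℕ n → Set
⟦ s ≐ t ⟧    ρ = ⟦ s ⟧t ρ ≡ ⟦ t ⟧t ρ
⟦ s ≺ t ⟧    ρ = ⟦ s ⟧t ρ < ⟦ t ⟧t ρ
⟦ ¬' φ ⟧     ρ = ¬ ⟦ φ ⟧ ρ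
⟦ φ ∧' ψ ⟧   ρ = ⟦ φ ⟧ ρ × ⟦ ψ ⟧ ρ
⟦ φ ∨' ψ ⟧   ρ = ⟦ φ ⟧ ρ ⊎ ⟦ ψ ⟧ ρ
⟦ ∀< t φ ⟧   ρ = (x : ℕ) → x < ⟦ t ⟧t ρ → ⟦ φ ⟧ (x ∷ ρ)
⟦ ∃< t φ ⟧   ρ = ∃ λ x → x < ⟦ t ⟧t ρ × ⟦ φ ⟧ (x ∷ ρ)

ExistsBlock : (k : ℕ) → (Vec ℕ k → Set) → Set
ExistsBlock k P = ∃ λ (xs : Vec ℕ k) → P xs

ForallBlock : (l : ℕ) → (Vec ℕ l → Set) → Set
ForallBlock l P = (ys : Vec ℕ l) → P ys

-- Standard bijective coding of binary strings by natural numbers.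
code : Str → ℕ
code []          = 0
code (false ∷ σ) = suc (2 * code σ)
code (true ∷ σ)  = suc (suc (2 * code σ))

Σ⁰₂ : (Str → Set) → Set
Σ⁰₂ U = Σ ℕ λ k → Σ ℕ λ l → Σ (Δ₀ (l + (k + 1))) λ θ →
  (σ : Str) → U σ ⇔
    ExistsBlock k (λ xs → ForallBlock l (λ ys → ⟦ θ ⟧ (ys ++ (xs ++ (code σ ∷ [])))))

-- U is {σ | ∃ x⃗ ∀ y⃗ θ(y⃗, x⃗, σ)} with θ bounded, so X has no prefix in U iff every prefix
-- X ↾ m and every x⃗ are refuted by some y⃗ with ¬ θ(y⃗, x⃗, X ↾ m).  By collection this holds iff
-- for every n there is an s such that all m, x⃗ below n are refuted by some y⃗ below s.  That
-- condition is primitive recursive in X and antitone in n, so the machine that on input n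
-- searches for such an s has a downward closed domain: it is total iff its domain is infinite
-- iff X has no prefix in U.  The machine is obtained by compiling θ into a primitive recursive
-- expression with an oracle, that into a LOOP program, and that into a register machine.
module Submission where

open import Defs
open import Level using (0ℓ)
open import Axiom.ExcludedMiddle using (ExcludedMiddle)
open import Data.Bool using (true; false)
open import Data.Empty using (⊥-elim)
open import Data.Fin using (Fin; zero; suc)
open import Data.List using (List; []; _∷_; length) renaming (_++_ to _++ᴸ_)
open import Data.List.Properties using (length-++)
open import Data.Maybe using (just; nothing)
open import Data.Nat using (ℕ; zero; suc; _+_; _*_; _∸_; _^_; _<_; _≤_; z≤n; s≤s; pred; _⊔_; _≡ᵇ_; _≟_)
open import Data.Nat.Properties
open import Data.Nat.Tactic.RingSolver using (solve-∀)
open import Data.Product using (Σ; ∃; _×_; _,_; proj₁; proj₂)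
open import Data.Sum using (_⊎_; inj₁; inj₂)
open import Data.Sum.Function.Propositional using (_⊎-⇔_)
open import Data.Unit using (⊤; tt)
open import Data.Vec using (Vec; []; _∷_; lookup; _++_)
open import Data.Vec.Relation.Unary.All as All using (All; []; _∷_)
open import Function.Bundles using (_⇔_; mk⇔; Equivalence)
open import Function.Construct.Composition using (_⇔-∘_)
open import Function.Construct.Symmetry using (⇔-sym)
open import Relation.Nullary using (¬_; Dec; yes; no)
open import Relation.Nullary.Decidable using (decidable-stable)
open import Relation.Binary.PropositionalEquality

-- Primitive recursive expressions with an oracle

-- In  rec c z s  the step s sees the accumulator as variable 0 and the recursion index as variable 1.
data Expr (n : ℕ) : Set where
  var    : Fin n → Expr n
  zer    : Expr n
  sc     : Expr n → Expr n
  oracle : Expr n → Expr n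
  rec    : Expr n → Expr n → Expr (suc (suc n)) → Expr n

natrec : ℕ → ℕ → (ℕ → ℕ → ℕ) → ℕ
natrec zero    z f = z
natrec (suc j) z f = f (natrec j z f) j

natrec-cong : ∀ c z {f g : ℕ → ℕ → ℕ} → (∀ a i → f a i ≡ g a i) →
  natrec c z f ≡ natrec c z g
natrec-cong zero    z         f≗g = refl
natrec-cong (suc c) z {f} {g} f≗g = trans (cong (λ a → f a c) (natrec-cong c z f≗g)) (f≗g _ c)

module Eval (X : Cantor) where
  eval : ∀ {n} → Expr n → Vec ℕ n → ℕ
  eval (var i)     ρ = lookup ρ i
  eval zer         ρ = 0
  eval (sc e)      ρ = suc (eval e ρ)
  eval (oracle e)  ρ = bit (X (eval e ρ))
  eval (rec c z s) ρ = natrec (eval c ρ) (eval z ρ) (λ a i → eval s (a ∷ i ∷ ρ))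

ext : ∀ {n m} → (Fin n → Fin m) → Fin (suc n) → Fin (suc m)
ext f zero    = zero
ext f (suc i) = suc (f i)

rename : ∀ {n m} → (Fin n → Fin m) → Expr n → Expr m
rename f (var i)     = var (f i)
rename f zer         = zer
rename f (sc e)      = sc (rename f e)
rename f (oracle e)  = oracle (rename f e)
rename f (rec c z s) = rec (rename f c) (rename f z) (rename (ext (ext f)) s)

weaken : ∀ {n} → Expr n → Expr (suc n)
weaken = rename suc

module _ (X : Cantor) where
  open Eval X

  eval-rename : ∀ {n m} (f : Fin n → Fin m) (e : Expr n) {ρ : Vec ℕ m} {ρ' : Vec ℕ n} →
    (∀ i → lookup ρ' i ≡ lookup ρ (f i)) → eval (rename f e) ρ ≡ eval e ρ'
  eval-rename f (var i)     ρ'≗ρ∘f = sym (ρ'≗ρ∘f i)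
  eval-rename f zer         ρ'≗ρ∘f = refl
  eval-rename f (sc e)      ρ'≗ρ∘f = cong suc (eval-rename f e ρ'≗ρ∘f)
  eval-rename f (oracle e)  ρ'≗ρ∘f = cong (λ v → bit (X v)) (eval-rename f e ρ'≗ρ∘f)
  eval-rename f (rec c z s) {ρ} {ρ'} ρ'≗ρ∘f =
    trans (cong₂ (λ c' z' → natrec c' z' _) (eval-rename f c ρ'≗ρ∘f) (eval-rename f z ρ'≗ρ∘f))
          (natrec-cong (eval c ρ') (eval z ρ') (λ a i → eval-rename (ext (ext f)) s (extended a i)))
    where
    extended : ∀ a i (j : Fin (suc (suc _))) → lookup (a ∷ i ∷ ρ') j ≡ lookup (a ∷ i ∷ ρ) (ext (ext f) j)
    extended a i zero          = refl
    extended a i (suc zero)    = refl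
    extended a i (suc (suc j)) = ρ'≗ρ∘f j

  eval-weaken : ∀ {n} (e : Expr n) x ρ → eval (weaken e) (x ∷ ρ) ≡ eval e ρ
  eval-weaken e x ρ = eval-rename suc e (λ i → refl)

predE : ∀ {n} → Expr n → Expr n
predE e = rec e zer (var (suc zero))

addE subE mulE : ∀ {n} → Expr n → Expr n → Expr n
addE a b = rec b a (sc (var zero))
subE a b = rec b a (predE (var zero))
mulE a b = rec b zer (addE (var zero) (weaken (weaken a)))

oneE : ∀ {n} → Expr n
oneE = sc zer

notE sgE pow2E : ∀ {n} → Expr n → Expr n
notE e = subE oneE e
sgE e   = notE (notE e)
pow2E e = rec e oneE (addE (var zero) (var zero))

skipAccumulator : ∀ {n} → Fin (suc n) → Fin (suc (suc n))
skipAccumulator zero    = suc zero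
skipAccumulator (suc i) = suc (suc i)

sumE : ∀ {n} → Expr n → Expr (suc n) → Expr n
sumE t e = rec t zer (addE (var zero) (rename skipAccumulator e))

-- code (X ↾ m) = Σ_{i<m} (1 + X i) 2^i
prefixCodeE : ∀ {n} → Expr n → Expr n
prefixCodeE e =
  rec e zer (addE (var zero) (mulE (sc (oracle (var (suc zero)))) (pow2E (var (suc zero)))))

sum< : ℕ → (ℕ → ℕ) → ℕ
sum< T f = natrec T 0 (λ a i → a + f i)

natrec-suc : ∀ a b → natrec b a (λ x _ → suc x) ≡ a + b
natrec-suc a zero    = sym (+-identityʳ a)
natrec-suc a (suc b) = trans (cong suc (natrec-suc a b)) (sym (+-suc a b))

natrec-pred : ∀ a b → natrec b a (λ x _ → pred x) ≡ a ∸ b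
natrec-pred a zero    = refl
natrec-pred a (suc b) = trans (cong pred (natrec-pred a b)) (pred[m∸n]≡m∸[1+n] a b)

natrec-+ : ∀ a b → natrec b 0 (λ x _ → x + a) ≡ b * a
natrec-+ a zero    = refl
natrec-+ a (suc b) = trans (cong (_+ a) (natrec-+ a b)) (+-comm (b * a) a)

natrec-double : ∀ j → natrec j 1 (λ x _ → x + x) ≡ 2 ^ j
natrec-double zero    = refl
natrec-double (suc j) =
  trans (cong (λ x → x + x) (natrec-double j)) (cong (2 ^ j +_) (sym (+-identityʳ (2 ^ j))))

code-cons : ∀ b σ → code (b ∷ σ) ≡ suc (bit b) + 2 * code σ
code-cons false σ = refl
code-cons true  σ = refl

shift : Cantor → Cantor
shift X i = X (suc i)

sum<-prefixWeights-suc : ∀ X m →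
  sum< (suc m) (λ i → suc (bit (X i)) * 2 ^ i) ≡
  suc (bit (X 0)) + 2 * sum< m (λ i → suc (bit (shift X i)) * 2 ^ i)
sum<-prefixWeights-suc X zero    = trans (*-identityʳ (suc (bit (X 0)))) (sym (+-identityʳ _))
sum<-prefixWeights-suc X (suc m) =
  trans (cong (_+ suc (bit (X (suc m))) * 2 ^ suc m) (sum<-prefixWeights-suc X m))
        (regroup (suc (bit (X 0))) (sum< m _) (suc (bit (X (suc m)))) (2 ^ m))
  where
  regroup : ∀ a g c p → (a + 2 * g) + c * (2 * p) ≡ a + 2 * (g + c * p)
  regroup = solve-∀

code-prefix : ∀ X m → code (X ↾ m) ≡ sum< m (λ i → suc (bit (X i)) * 2 ^ i)
code-prefix X zero    = refl
code-prefix X (suc m) = begin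
  code (X ↾ suc m)                           ≡⟨ code-cons (X 0) (shift X ↾ m) ⟩
  suc (bit (X 0)) + 2 * code (shift X ↾ m)   ≡⟨ cong (λ v → suc (bit (X 0)) + 2 * v) (code-prefix (shift X) m) ⟩
  suc (bit (X 0)) + 2 * sum< m _             ≡⟨ sym (sum<-prefixWeights-suc X m) ⟩
  sum< (suc m) (λ i → suc (bit (X i)) * 2 ^ i) ∎
  where open ≡-Reasoning

module _ (X : Cantor) where
  open Eval X

  eval-addE : ∀ {n} a b (ρ : Vec ℕ n) → eval (addE a b) ρ ≡ eval a ρ + eval b ρ
  eval-addE a b ρ = natrec-suc (eval a ρ) (eval b ρ)

  eval-subE : ∀ {n} a b (ρ : Vec ℕ n) → eval (subE a b) ρ ≡ eval a ρ ∸ eval b ρ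
  eval-subE a b ρ =
    trans (natrec-cong (eval b ρ) (eval a ρ) (λ x _ → eval-predE x)) (natrec-pred (eval a ρ) (eval b ρ))
    where
    eval-predE : ∀ x → natrec x 0 (λ _ j → j) ≡ pred x
    eval-predE zero    = refl
    eval-predE (suc x) = refl

  eval-mulE : ∀ {n} a b (ρ : Vec ℕ n) → eval (mulE a b) ρ ≡ eval a ρ * eval b ρ
  eval-mulE a b ρ =
    trans (natrec-cong (eval b ρ) 0 adds-a)
          (trans (natrec-+ (eval a ρ) (eval b ρ)) (*-comm (eval b ρ) (eval a ρ)))
    where
    adds-a : ∀ x i → eval (addE (var zero) (weaken (weaken a))) (x ∷ i ∷ ρ) ≡ x + eval a ρ
    adds-a x i = trans (eval-addE (var zero) (weaken (weaken a)) (x ∷ i ∷ ρ))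
                     (cong (x +_) (trans (eval-weaken X (weaken a) x (i ∷ ρ)) (eval-weaken X a i ρ)))

  eval-notE : ∀ {n} a (ρ : Vec ℕ n) → eval (notE a) ρ ≡ 1 ∸ eval a ρ
  eval-notE a ρ = eval-subE oneE a ρ

  eval-sgE : ∀ {n} a (ρ : Vec ℕ n) → eval (sgE a) ρ ≡ 1 ∸ (1 ∸ eval a ρ)
  eval-sgE a ρ = trans (eval-notE (notE a) ρ) (cong (1 ∸_) (eval-notE a ρ))

  eval-pow2E : ∀ {n} a (ρ : Vec ℕ n) → eval (pow2E a) ρ ≡ 2 ^ eval a ρ
  eval-pow2E a ρ =
    trans (natrec-cong (eval a ρ) 1 (λ x i → eval-addE (var zero) (var zero) (x ∷ i ∷ ρ)))
          (natrec-double (eval a ρ))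

  eval-sumE : ∀ {n} t e (ρ : Vec ℕ n) → eval (sumE t e) ρ ≡ sum< (eval t ρ) (λ x → eval e (x ∷ ρ))
  eval-sumE t e ρ = natrec-cong (eval t ρ) 0 λ a i →
    trans (eval-addE (var zero) (rename skipAccumulator e) (a ∷ i ∷ ρ))
          (cong (a +_) (eval-rename X skipAccumulator e (skipped a i)))
    where
    skipped : ∀ a i j → lookup (i ∷ ρ) j ≡ lookup (a ∷ i ∷ ρ) (skipAccumulator j)
    skipped a i zero    = refl
    skipped a i (suc j) = refl

  eval-prefixCodeE : ∀ {n} e (ρ : Vec ℕ n) → eval (prefixCodeE e) ρ ≡ code (X ↾ eval e ρ)
  eval-prefixCodeE {n} e ρ = trans (natrec-cong (eval e ρ) 0 adds-weight) (sym (code-prefix X (eval e ρ)))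
    where
    weight : Expr (suc (suc n))
    weight = mulE (sc (oracle (var (suc zero)))) (pow2E (var (suc zero)))
    adds-weight : ∀ a i → eval (addE (var zero) weight) (a ∷ i ∷ ρ) ≡ a + suc (bit (X i)) * 2 ^ i
    adds-weight a i = trans (eval-addE (var zero) weight (a ∷ i ∷ ρ)) (cong (a +_)
      (trans (eval-mulE (sc (oracle (var (suc zero)))) (pow2E (var (suc zero))) (a ∷ i ∷ ρ))
             (cong (suc (bit (X i)) *_) (eval-pow2E (var (suc zero)) (a ∷ i ∷ ρ)))))

-- Evaluating bounded formulas

Indicator : ℕ → Set → Set
Indicator v P = (v ≡ 1 × P) ⊎ (v ≡ 0 × ¬ P)

indicator-cong : ∀ {v w P} → v ≡ w → Indicator w P → Indicator v P
indicator-cong refl χ = χ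

indicator-⇔ : ∀ {v P Q} → P ⇔ Q → Indicator v P → Indicator v Q
indicator-⇔ P⇔Q (inj₁ (v≡1 , p))  = inj₁ (v≡1 , Equivalence.to P⇔Q p)
indicator-⇔ P⇔Q (inj₂ (v≡0 , ¬p)) = inj₂ (v≡0 , λ q → ¬p (Equivalence.from P⇔Q q))

indicator-true : ∀ {v P} → Indicator v P → P → v ≡ 1
indicator-true (inj₁ (v≡1 , _)) p = v≡1
indicator-true (inj₂ (_ , ¬p))  p = ⊥-elim (¬p p)

indicator-false : ∀ {v P} → Indicator v P → ¬ P → v ≡ 0
indicator-false (inj₁ (_ , p))   ¬p = ⊥-elim (¬p p)
indicator-false (inj₂ (v≡0 , _)) ¬p = v≡0

indicator-dec : ∀ {v P} → Indicator v P → Dec P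
indicator-dec (inj₁ (_ , p))  = yes p
indicator-dec (inj₂ (_ , ¬p)) = no ¬p

indicator-positive⇔ : ∀ {v P} → Indicator v P → 0 < v ⇔ P
indicator-positive⇔ (inj₁ (refl , p))  = mk⇔ (λ _ → p) (λ _ → s≤s z≤n)
indicator-positive⇔ (inj₂ (refl , ¬p)) = mk⇔ (λ ()) (λ p → ⊥-elim (¬p p))

indicator-¬ : ∀ {v P} → Indicator v P → Indicator (1 ∸ v) (¬ P)
indicator-¬ (inj₁ (refl , p))  = inj₂ (refl , λ ¬p → ¬p p)
indicator-¬ (inj₂ (refl , ¬p)) = inj₁ (refl , ¬p)

indicator-× : ∀ {v w P Q} → Indicator v P → Indicator w Q → Indicator (v * w) (P × Q)
indicator-× (inj₁ (refl , p))  (inj₁ (refl , q))  = inj₁ (refl , (p , q))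
indicator-× (inj₁ (refl , p))  (inj₂ (refl , ¬q)) = inj₂ (refl , λ pq → ¬q (proj₂ pq))
indicator-× (inj₂ (refl , ¬p)) _                  = inj₂ (refl , λ pq → ¬p (proj₁ pq))

positive-indicator : ∀ v → Indicator (1 ∸ (1 ∸ v)) (0 < v)
positive-indicator zero    = inj₂ (refl , λ ())
positive-indicator (suc v) = inj₁ (cong (1 ∸_) (0∸n≡0 v) , s≤s z≤n)

positive-+⇔ : ∀ a b → 0 < a + b ⇔ (0 < a ⊎ 0 < b)
positive-+⇔ zero    b = mk⇔ inj₂ λ { (inj₁ ()) ; (inj₂ 0<b) → 0<b }
positive-+⇔ (suc a) b = mk⇔ (λ _ → inj₁ (s≤s z≤n)) (λ _ → s≤s z≤n)

positive-sum<⇔ : ∀ T f → 0 < sum< T f ⇔ (∃ λ x → x < T × 0 < f x)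
positive-sum<⇔ zero    f = mk⇔ (λ ()) (λ { (_ , () , _) })
positive-sum<⇔ (suc T) f = mk⇔ to from
  where
  to : 0 < sum< T f + f T → ∃ λ x → x < suc T × 0 < f x
  to pos with Equivalence.to (positive-+⇔ (sum< T f) (f T)) pos
  ... | inj₁ 0<Σ  = let (x , x<T , 0<fx) = Equivalence.to (positive-sum<⇔ T f) 0<Σ
                    in x , m<n⇒m<1+n x<T , 0<fx
  ... | inj₂ 0<fT = T , n<1+n T , 0<fT
  from : (∃ λ x → x < suc T × 0 < f x) → 0 < sum< T f + f T
  from (x , x<1+T , 0<fx) = Equivalence.from (positive-+⇔ (sum< T f) (f T)) (earlier (m<1+n⇒m<n∨m≡n x<1+T))
    where
    earlier : x < T ⊎ x ≡ T → 0 < sum< T f ⊎ 0 < f T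
    earlier (inj₁ x<T)  = inj₁ (Equivalence.from (positive-sum<⇔ T f) (x , x<T , 0<fx))
    earlier (inj₂ refl) = inj₂ 0<fx

0<∸⇔< : ∀ a b → 0 < b ∸ a ⇔ a < b
0<∸⇔< a b = mk⇔ (λ 0<b∸a → ≰⇒> λ b≤a → <⇒≢ 0<b∸a (sym (m≤n⇒m∸n≡0 b≤a))) m<n⇒0<n∸m

¬[<⊎>]⇔≡ : ∀ a b → (¬ (a < b ⊎ b < a)) ⇔ a ≡ b
¬[<⊎>]⇔≡ a b = mk⇔
  (λ ¬a≶b → ≤-antisym (≮⇒≥ (λ b<a → ¬a≶b (inj₂ b<a))) (≮⇒≥ (λ a<b → ¬a≶b (inj₁ a<b))))
  (λ { refl (inj₁ a<a) → <-irrefl refl a<a ; refl (inj₂ a<a) → <-irrefl refl a<a })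

ltE orE eqE : ∀ {n} → Expr n → Expr n → Expr n
ltE a b = sgE (subE b a)
orE a b = sgE (addE a b)
eqE a b = notE (orE (ltE a b) (ltE b a))

existsE forallE : ∀ {n} → Expr n → Expr (suc n) → Expr n
existsE t e = sgE (sumE t e)
forallE t e = notE (existsE t (notE e))

module _ (X : Cantor) where
  open Eval X

  sgE-indicates : ∀ {n} a (ρ : Vec ℕ n) {v} → eval a ρ ≡ v → Indicator (eval (sgE a) ρ) (0 < v)
  sgE-indicates a ρ refl = indicator-cong (eval-sgE X a ρ) (positive-indicator (eval a ρ))

  notE-indicates : ∀ {n} a (ρ : Vec ℕ n) {P} → Indicator (eval a ρ) P → Indicator (eval (notE a) ρ) (¬ P)
  notE-indicates a ρ χ = indicator-cong (eval-notE X a ρ) (indicator-¬ χ)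

  mulE-indicates : ∀ {n} a b (ρ : Vec ℕ n) {P Q} →
    Indicator (eval a ρ) P → Indicator (eval b ρ) Q → Indicator (eval (mulE a b) ρ) (P × Q)
  mulE-indicates a b ρ χ ψ = indicator-cong (eval-mulE X a b ρ) (indicator-× χ ψ)

  ltE-indicates : ∀ {n} a b (ρ : Vec ℕ n) {A B} → eval a ρ ≡ A → eval b ρ ≡ B →
    Indicator (eval (ltE a b) ρ) (A < B)
  ltE-indicates a b ρ refl refl =
    indicator-⇔ (0<∸⇔< (eval a ρ) (eval b ρ)) (sgE-indicates (subE b a) ρ (eval-subE X b a ρ))

  orE-indicates : ∀ {n} a b (ρ : Vec ℕ n) {P Q} →
    Indicator (eval a ρ) P → Indicator (eval b ρ) Q → Indicator (eval (orE a b) ρ) (P ⊎ Q)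
  orE-indicates a b ρ χ ψ =
    indicator-⇔ ((indicator-positive⇔ χ ⊎-⇔ indicator-positive⇔ ψ) ⇔-∘ positive-+⇔ (eval a ρ) (eval b ρ))
      (sgE-indicates (addE a b) ρ (eval-addE X a b ρ))

  eqE-indicates : ∀ {n} a b (ρ : Vec ℕ n) {A B} → eval a ρ ≡ A → eval b ρ ≡ B →
    Indicator (eval (eqE a b) ρ) (A ≡ B)
  eqE-indicates a b ρ {A} {B} a≡A b≡B = indicator-⇔ (¬[<⊎>]⇔≡ A B)
    (notE-indicates (orE (ltE a b) (ltE b a)) ρ
      (orE-indicates (ltE a b) (ltE b a) ρ (ltE-indicates a b ρ a≡A b≡B) (ltE-indicates b a ρ b≡B a≡A)))

  existsE-indicates : ∀ {n} t e (ρ : Vec ℕ n) {T} → eval t ρ ≡ T → {P : ℕ → Set} →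
    (∀ x → Indicator (eval e (x ∷ ρ)) (P x)) → Indicator (eval (existsE t e) ρ) (∃ λ x → x < T × P x)
  existsE-indicates t e ρ refl χ = indicator-⇔
    (mk⇔ (λ (x , x<t , 0<ex) → x , x<t , Equivalence.to (indicator-positive⇔ (χ x)) 0<ex)
         (λ (x , x<t , px) → x , x<t , Equivalence.from (indicator-positive⇔ (χ x)) px)
     ⇔-∘ positive-sum<⇔ (eval t ρ) (λ x → eval e (x ∷ ρ)))
    (sgE-indicates (sumE t e) ρ (eval-sumE X t e ρ))

  forallE-indicates : ∀ {n} t e (ρ : Vec ℕ n) {T} → eval t ρ ≡ T → {P : ℕ → Set} →
    (∀ x → Indicator (eval e (x ∷ ρ)) (P x)) → Indicator (eval (forallE t e) ρ) (∀ x → x < T → P x)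
  forallE-indicates t e ρ {T} t≡T {P} χ =
    indicator-⇔ (mk⇔ no-counterexample (λ ∀p (x , x<T , ¬px) → ¬px (∀p x x<T)))
      (notE-indicates (existsE t (notE e)) ρ
        (existsE-indicates t (notE e) ρ t≡T (λ x → notE-indicates e (x ∷ ρ) (χ x))))
    where
    no-counterexample : ¬ (∃ λ x → x < T × ¬ P x) → ∀ x → x < T → P x
    no-counterexample ¬∃ x x<T with indicator-dec (χ x)
    ... | yes px = px
    ... | no ¬px = ⊥-elim (¬∃ (x , x<T , ¬px))

extS : ∀ {n m} → (Fin n → Expr m) → Fin (suc n) → Expr (suc m)
extS σ zero    = var zero
extS σ (suc i) = weaken (σ i)

translateTerm : ∀ {n m} → Term n → (Fin n → Expr m) → Expr m
translateTerm (var i) σ = σ i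
translateTerm zer     σ = zer
translateTerm (sc t)  σ = sc (translateTerm t σ)
translateTerm (s ⊕ t) σ = addE (translateTerm s σ) (translateTerm t σ)
translateTerm (s ⊗ t) σ = mulE (translateTerm s σ) (translateTerm t σ)

translate : ∀ {n m} → Δ₀ n → (Fin n → Expr m) → Expr m
translate (s ≐ t)  σ = eqE (translateTerm s σ) (translateTerm t σ)
translate (s ≺ t)  σ = ltE (translateTerm s σ) (translateTerm t σ)
translate (¬' φ)   σ = notE (translate φ σ)
translate (φ ∧' ψ) σ = mulE (translate φ σ) (translate ψ σ)
translate (φ ∨' ψ) σ = orE (translate φ σ) (translate ψ σ)
translate (∀< t φ) σ = forallE (translateTerm t σ) (translate φ (extS σ))
translate (∃< t φ) σ = existsE (translateTerm t σ) (translate φ (extS σ))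

module _ (X : Cantor) where
  open Eval X

  EvaluatesTo : ∀ {n m} → (Fin n → Expr m) → Vec ℕ m → Vec ℕ n → Set
  EvaluatesTo σ ρ ρ' = ∀ i → eval (σ i) ρ ≡ lookup ρ' i

  extS-evaluatesTo : ∀ {n m} {σ : Fin n → Expr m} {ρ ρ'} x →
    EvaluatesTo σ ρ ρ' → EvaluatesTo (extS σ) (x ∷ ρ) (x ∷ ρ')
  extS-evaluatesTo x σ↦ρ' zero    = refl
  extS-evaluatesTo {σ = σ} {ρ} x σ↦ρ' (suc i) = trans (eval-weaken X (σ i) x ρ) (σ↦ρ' i)

  eval-translateTerm : ∀ {n m} (t : Term n) {σ : Fin n → Expr m} {ρ ρ'} →
    EvaluatesTo σ ρ ρ' → eval (translateTerm t σ) ρ ≡ ⟦ t ⟧t ρ'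
  eval-translateTerm (var i) σ↦ρ' = σ↦ρ' i
  eval-translateTerm zer     σ↦ρ' = refl
  eval-translateTerm (sc t)  σ↦ρ' = cong suc (eval-translateTerm t σ↦ρ')
  eval-translateTerm (s ⊕ t) {σ} {ρ} σ↦ρ' =
    trans (eval-addE X (translateTerm s σ) (translateTerm t σ) ρ)
          (cong₂ _+_ (eval-translateTerm s σ↦ρ') (eval-translateTerm t σ↦ρ'))
  eval-translateTerm (s ⊗ t) {σ} {ρ} σ↦ρ' =
    trans (eval-mulE X (translateTerm s σ) (translateTerm t σ) ρ)
          (cong₂ _*_ (eval-translateTerm s σ↦ρ') (eval-translateTerm t σ↦ρ'))

  translate-indicates : ∀ {n m} (φ : Δ₀ n) {σ : Fin n → Expr m} {ρ ρ'} →
    EvaluatesTo σ ρ ρ' → Indicator (eval (translate φ σ) ρ) (⟦ φ ⟧ ρ')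
  translate-indicates (s ≐ t) {σ} {ρ} σ↦ρ' =
    eqE-indicates X (translateTerm s σ) (translateTerm t σ) ρ (eval-translateTerm s σ↦ρ') (eval-translateTerm t σ↦ρ')
  translate-indicates (s ≺ t) {σ} {ρ} σ↦ρ' =
    ltE-indicates X (translateTerm s σ) (translateTerm t σ) ρ (eval-translateTerm s σ↦ρ') (eval-translateTerm t σ↦ρ')
  translate-indicates (¬' φ) {σ} {ρ} σ↦ρ' =
    notE-indicates X (translate φ σ) ρ (translate-indicates φ σ↦ρ')
  translate-indicates (φ ∧' ψ) {σ} {ρ} σ↦ρ' =
    mulE-indicates X (translate φ σ) (translate ψ σ) ρ (translate-indicates φ σ↦ρ') (translate-indicates ψ σ↦ρ')
  translate-indicates (φ ∨' ψ) {σ} {ρ} σ↦ρ' =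
    orE-indicates X (translate φ σ) (translate ψ σ) ρ (translate-indicates φ σ↦ρ') (translate-indicates ψ σ↦ρ')
  translate-indicates (∀< t φ) {σ} {ρ} σ↦ρ' =
    forallE-indicates X (translateTerm t σ) (translate φ (extS σ)) ρ (eval-translateTerm t σ↦ρ')
      (λ x → translate-indicates φ (extS-evaluatesTo x σ↦ρ'))
  translate-indicates (∃< t φ) {σ} {ρ} σ↦ρ' =
    existsE-indicates X (translateTerm t σ) (translate φ (extS σ)) ρ (eval-translateTerm t σ↦ρ')
      (λ x → translate-indicates φ (extS-evaluatesTo x σ↦ρ'))

weakenN : ∀ {m} (k : ℕ) → Expr m → Expr (k + m)
weakenN zero    t = t
weakenN (suc k) t = weaken (weakenN k t)

forallE* existsE* : ∀ {m} (k : ℕ) → Expr m → Expr (k + m) → Expr m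
forallE* zero    t e = e
forallE* (suc k) t e = forallE* k t (forallE (weakenN k t) e)
existsE* zero    t e = e
existsE* (suc k) t e = existsE* k t (existsE (weakenN k t) e)

extS* : ∀ {n m} (j : ℕ) → (Fin n → Expr m) → Fin (j + n) → Expr (j + m)
extS* zero    σ = σ
extS* (suc j) σ = extS (extS* j σ)

codeOfPrefix₀ : Fin 1 → Expr 3
codeOfPrefix₀ zero = prefixCodeE (var zero)

-- Context (y⃗, x⃗, m, n, s); the string variable of θ is instantiated by code (X ↾ m).
counterexampleE : (k l : ℕ) → Δ₀ (l + (k + 1)) → Expr (l + (k + 3))
counterexampleE k l θ = notE (translate θ (extS* l (extS* k codeOfPrefix₀)))

refutedE : (k l : ℕ) → Δ₀ (l + (k + 1)) → Expr 2
refutedE k l θ =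
  forallE (var zero) (forallE* k (var (suc zero))
    (existsE* l (weakenN k (var (suc (suc zero)))) (counterexampleE k l θ)))

RefutedBelow : (k l : ℕ) → Δ₀ (l + (k + 1)) → Cantor → ℕ → Vec ℕ k → ℕ → Set
RefutedBelow k l θ X m xs s = ∃ λ (ys : Vec ℕ l) → All (_< s) ys × ¬ ⟦ θ ⟧ (ys ++ (xs ++ (code (X ↾ m) ∷ [])))

Refuted : (k l : ℕ) → Δ₀ (l + (k + 1)) → Cantor → ℕ → ℕ → Set
Refuted k l θ X n s = ∀ m → m < n → ∀ (xs : Vec ℕ k) → All (_< n) xs → RefutedBelow k l θ X m xs s

module _ (X : Cantor) where
  open Eval X

  eval-weakenN : ∀ {m k} (t : Expr m) (ys : Vec ℕ k) ρ → eval (weakenN k t) (ys ++ ρ) ≡ eval t ρ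
  eval-weakenN t []                 ρ = refl
  eval-weakenN {k = suc k} t (y ∷ ys) ρ = trans (eval-weaken X (weakenN k t) y (ys ++ ρ)) (eval-weakenN t ys ρ)

  forallE*-indicates : ∀ {m} k t e (ρ : Vec ℕ m) {T} → eval t ρ ≡ T → {P : Vec ℕ k → Set} →
    (∀ xs → Indicator (eval e (xs ++ ρ)) (P xs)) →
    Indicator (eval (forallE* k t e) ρ) (∀ xs → All (_< T) xs → P xs)
  forallE*-indicates zero t e ρ t≡T χ = indicator-⇔ (mk⇔ (λ { p [] [] → p }) (λ ∀p → ∀p [] [])) (χ [])
  forallE*-indicates (suc k) t e ρ t≡T χ = indicator-⇔
    (mk⇔ (λ { ∀p (x ∷ ys) (x<T ∷ ys<T) → ∀p ys ys<T x x<T })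
         (λ ∀p ys ys<T x x<T → ∀p (x ∷ ys) (x<T ∷ ys<T)))
    (forallE*-indicates k t (forallE (weakenN k t) e) ρ t≡T λ ys →
      forallE-indicates X (weakenN k t) e (ys ++ ρ) (trans (eval-weakenN t ys ρ) t≡T) (λ x → χ (x ∷ ys)))

  existsE*-indicates : ∀ {m} k t e (ρ : Vec ℕ m) {T} → eval t ρ ≡ T → {P : Vec ℕ k → Set} →
    (∀ xs → Indicator (eval e (xs ++ ρ)) (P xs)) →
    Indicator (eval (existsE* k t e) ρ) (∃ λ xs → All (_< T) xs × P xs)
  existsE*-indicates zero t e ρ t≡T χ = indicator-⇔ (mk⇔ (λ p → [] , [] , p) (λ { ([] , [] , p) → p })) (χ [])
  existsE*-indicates (suc k) t e ρ t≡T χ = indicator-⇔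
    (mk⇔ (λ (ys , ys<T , x , x<T , p) → x ∷ ys , x<T ∷ ys<T , p)
         (λ { (x ∷ ys , x<T ∷ ys<T , p) → ys , ys<T , x , x<T , p }))
    (existsE*-indicates k t (existsE (weakenN k t) e) ρ t≡T λ ys →
      existsE-indicates X (weakenN k t) e (ys ++ ρ) (trans (eval-weakenN t ys ρ) t≡T) (λ x → χ (x ∷ ys)))

  extS*-evaluatesTo : ∀ {n m} j {σ : Fin n → Expr m} {ρ ρ'} (zs : Vec ℕ j) →
    EvaluatesTo X σ ρ ρ' → EvaluatesTo X (extS* j σ) (zs ++ ρ) (zs ++ ρ')
  extS*-evaluatesTo zero    []       σ↦ρ' = σ↦ρ'
  extS*-evaluatesTo (suc j) (z ∷ zs) σ↦ρ' = extS-evaluatesTo X z (extS*-evaluatesTo j zs σ↦ρ')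

  refutedE-indicates : ∀ k l θ n s → Indicator (eval (refutedE k l θ) (n ∷ s ∷ [])) (Refuted k l θ X n s)
  refutedE-indicates k l θ n s =
    forallE-indicates X (var zero) (forallE* k (var (suc zero)) refutations) (n ∷ s ∷ []) refl λ m →
    forallE*-indicates k (var (suc zero)) refutations (m ∷ n ∷ s ∷ []) refl λ xs →
    existsE*-indicates l (weakenN k (var (suc (suc zero)))) (counterexampleE k l θ) (xs ++ (m ∷ n ∷ s ∷ []))
      (eval-weakenN (var (suc (suc zero))) xs (m ∷ n ∷ s ∷ [])) λ ys →
    notE-indicates X (translate θ (extS* l (extS* k codeOfPrefix₀))) (ys ++ (xs ++ (m ∷ n ∷ s ∷ [])))
      (translate-indicates X θ (extS*-evaluatesTo l ys (extS*-evaluatesTo k xs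
        λ { zero → eval-prefixCodeE X (var zero) (m ∷ n ∷ s ∷ []) })))
    where
    refutations : Expr (k + 3)
    refutations = existsE* l (weakenN k (var (suc (suc zero)))) (counterexampleE k l θ)

-- LOOP programs

set-hit : ∀ R r v → set R r v r ≡ v
set-hit R r v with r ≡ᵇ r | ≡⇒≡ᵇ r r refl
... | true | _ = refl

set-miss : ∀ R r v {i} → i ≢ r → set R r v i ≡ R i
set-miss R r v {i} i≢r with i ≡ᵇ r | ≡ᵇ⇒≡ i r
... | true  | i≡r = ⊥-elim (i≢r (i≡r tt))
... | false | _   = refl

-- loop r p  first clears r and then runs p as many times as r was worth.
data Loop : Set where
  skip  : Loop
  incL  : ℕ → Loop
  orcL  : ℕ → Loop
  _⨾_   : Loop → Loop → Loop
  loop  : ℕ → Loop → Loop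

infixr 5 _⨾_

iter : {A : Set} → ℕ → (A → A) → A → A
iter zero    f a = a
iter (suc n) f a = iter n f (f a)

runL : Cantor → Loop → Regs → Regs
runL X skip       R = R
runL X (incL r)   R = set R r (suc (R r))
runL X (orcL r)   R = set R r (bit (X (R r)))
runL X (p ⨾ q)    R = runL X q (runL X p R)
runL X (loop r p) R = iter (R r) (runL X p) (set R r 0)

iter-preserves : ∀ (f : Regs → Regs) i → (∀ W → f W i ≡ W i) → ∀ v W → iter v f W i ≡ W i
iter-preserves f i fix zero    W = refl
iter-preserves f i fix (suc v) W = trans (iter-preserves f i fix v (f W)) (fix W)

iter-increments : ∀ (f : Regs → Regs) i → (∀ W → f W i ≡ suc (W i)) → ∀ v W → iter v f W i ≡ v + W i
iter-increments f i incr zero    W = refl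
iter-increments f i incr (suc v) W =
  trans (iter-increments f i incr v (f W)) (trans (cong (v +_) (incr W)) (+-suc v (W i)))

iter-invariant : ∀ {A : Set} (f : A → A) (Inv : ℕ → A → Set) → (∀ j W → Inv j W → Inv (suc j) (f W)) →
  ∀ v W → Inv 0 W → Inv v (iter v f W)
iter-invariant f Inv advance v W inv0 = subst (λ k → Inv k (iter v f W)) (+-identityʳ v) (go v 0 W inv0)
  where
  go : ∀ v j W → Inv j W → Inv (v + j) (iter v f W)
  go zero    j W inv = inv
  go (suc v) j W inv = subst (λ k → Inv k (iter v f (f W))) (+-suc v j) (go v (suc j) (f W) (advance j W inv))

clear : ℕ → Loop
clear r = loop r skip

addTo : ℕ → ℕ → Loop
addTo s t = loop s (incL t)

module _ (X : Cantor) where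

  record Preserves (p : Loop) (j : ℕ) : Set where
    constructor preserving
    field preserved : ∀ U → runL X p U j ≡ U j
  open Preserves public

  preserves-skip : ∀ {j} → Preserves skip j
  preserves-skip = preserving λ U → refl

  preserves-incL : ∀ {r j} → j ≢ r → Preserves (incL r) j
  preserves-incL {r} j≢r = preserving λ U → set-miss U r _ j≢r

  preserves-orcL : ∀ {r j} → j ≢ r → Preserves (orcL r) j
  preserves-orcL {r} j≢r = preserving λ U → set-miss U r _ j≢r

  preserves-⨾ : ∀ {p q j} → Preserves p j → Preserves q j → Preserves (p ⨾ q) j
  preserves-⨾ {p} (preserving p-pres) (preserving q-pres) =
    preserving λ U → trans (q-pres (runL X p U)) (p-pres U)

  preserves-loop : ∀ {r p j} → j ≢ r → Preserves p j → Preserves (loop r p) j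
  preserves-loop {r} {p} j≢r (preserving pres) = preserving λ U →
    trans (iter-preserves (runL X p) _ pres (U r) (set U r 0)) (set-miss U r 0 j≢r)

  preserves-clear : ∀ {r j} → j ≢ r → Preserves (clear r) j
  preserves-clear j≢r = preserves-loop j≢r preserves-skip

  preserves-addTo : ∀ {s t j} → j ≢ s → j ≢ t → Preserves (addTo s t) j
  preserves-addTo j≢s j≢t = preserves-loop j≢s (preserves-incL j≢t)

  loop-increments : ∀ {r j} p → j ≢ r → (∀ W → runL X p W j ≡ suc (W j)) →
    ∀ U → runL X (loop r p) U j ≡ U r + U j
  loop-increments {r} {j} p j≢r incr U =
    trans (iter-increments (runL X p) j incr (U r) (set U r 0)) (cong (U r +_) (set-miss U r 0 j≢r))

  loop-moves : ∀ {r t} p → t ≢ r → (∀ W → runL X p W t ≡ suc (W t)) →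
    ∀ U → U t ≡ 0 → runL X (loop r p) U t ≡ U r
  loop-moves {r} {t} p t≢r incr U empty =
    trans (loop-increments p t≢r incr U) (trans (cong (U r +_) empty) (+-identityʳ (U r)))

  loop-clears : ∀ {r} p → Preserves p r → ∀ U → runL X (loop r p) U r ≡ 0
  loop-clears {r} p (preserving pres) U =
    trans (iter-preserves (runL X p) r pres (U r) (set U r 0)) (set-hit U r 0)

  incL-increments : ∀ r W → runL X (incL r) W r ≡ suc (W r)
  incL-increments r W = set-hit W r (suc (W r))

  clear-clears : ∀ r U → runL X (clear r) U r ≡ 0
  clear-clears r = loop-clears skip preserves-skip

  addTo-moves : ∀ {s t} → t ≢ s → ∀ U → U t ≡ 0 → runL X (addTo s t) U t ≡ U s
  addTo-moves {t = t} t≢s = loop-moves (incL t) t≢s (incL-increments t)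

duplicate : ℕ → ℕ → Loop
duplicate r b = clear b ⨾ clear (suc b) ⨾ loop r (incL b ⨾ incL (suc b))

copy : ℕ → ℕ → Loop
copy r b = duplicate r b ⨾ addTo (suc b) r

-- In  rec c z s  with target b: b counts down the iterations, b + 1 is the accumulator,
-- b + 2 the index, and the step is evaluated at b + 3.
bindStep : ∀ {n} → (Fin n → ℕ) → ℕ → Fin (suc (suc n)) → ℕ
bindStep env b zero          = suc b
bindStep env b (suc zero)    = suc (suc b)
bindStep env b (suc (suc i)) = env i

mutual
  compile : ∀ {n} → Expr n → (Fin n → ℕ) → ℕ → Loop
  compile (var i)     env b = copy (env i) b
  compile zer         env b = clear b
  compile (sc e)      env b = compile e env b ⨾ incL b
  compile (oracle e)  env b = compile e env b ⨾ orcL b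
  compile (rec c z s) env b =
    compile c env b ⨾ compile z env (suc b) ⨾ clear (2 + b) ⨾ loop b (recStep s env b) ⨾ addTo (suc b) b

  recStep : ∀ {n} → Expr (suc (suc n)) → (Fin n → ℕ) → ℕ → Loop
  recStep s env b = compile s (bindStep env b) (3 + b) ⨾ clear (1 + b) ⨾ addTo (3 + b) (1 + b) ⨾ incL (2 + b)

m<n⇒m≢o+n : ∀ {m n} o → m < n → m ≢ o + n
m<n⇒m≢o+n {n = n} o m<n = <⇒≢ (<-≤-trans m<n (m≤n+m n o))

module _ (X : Cantor) where

  duplicate-keeps : ∀ {r b} → r < b → Preserves X (clear b ⨾ clear (suc b)) r
  duplicate-keeps r<b = preserves-⨾ X (preserves-clear X (<⇒≢ r<b)) (preserves-clear X (m<n⇒m≢o+n 1 r<b))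

  duplicate-moves₀ : ∀ {r b} → r < b → ∀ U → runL X (duplicate r b) U b ≡ U r
  duplicate-moves₀ {r} {b} r<b U =
    trans (loop-moves X (incL b ⨾ incL (suc b)) (≢-sym (<⇒≢ r<b)) increments U₁ cleared)
          (preserved (duplicate-keeps r<b) U)
    where
    U₁ : Regs
    U₁ = runL X (clear b ⨾ clear (suc b)) U
    cleared : U₁ b ≡ 0
    cleared = trans (preserved (preserves-clear X (m≢1+n+m b {0})) (runL X (clear b) U)) (clear-clears X b U)
    increments : ∀ W → runL X (incL b ⨾ incL (suc b)) W b ≡ suc (W b)
    increments W = trans (preserved (preserves-incL X (m≢1+n+m b {0})) (runL X (incL b) W)) (incL-increments X b W)

  duplicate-moves₁ : ∀ {r b} → r < b → ∀ U → runL X (duplicate r b) U (suc b) ≡ U r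
  duplicate-moves₁ {r} {b} r<b U =
    trans (loop-moves X (incL b ⨾ incL (suc b)) (≢-sym (m<n⇒m≢o+n 1 r<b)) increments U₁
                      (clear-clears X (suc b) (runL X (clear b) U)))
          (preserved (duplicate-keeps r<b) U)
    where
    U₁ : Regs
    U₁ = runL X (clear b ⨾ clear (suc b)) U
    increments : ∀ W → runL X (incL b ⨾ incL (suc b)) W (suc b) ≡ suc (W (suc b))
    increments W = trans (incL-increments X (suc b) (runL X (incL b) W))
                         (cong suc (preserved (preserves-incL X (≢-sym (m≢1+n+m b {0}))) W))

  duplicate-empties : ∀ {r b} → r < b → ∀ U → runL X (duplicate r b) U r ≡ 0
  duplicate-empties {r} {b} r<b U = loop-clears X (incL b ⨾ incL (suc b))
    (preserves-⨾ X (preserves-incL X (<⇒≢ r<b)) (preserves-incL X (m<n⇒m≢o+n 1 r<b))) (runL X (clear b ⨾ clear (suc b)) U)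

  copy-copies : ∀ {r b} → r < b → ∀ U → runL X (copy r b) U b ≡ U r
  copy-copies {r} {b} r<b U =
    trans (preserved (preserves-addTo X (m≢1+n+m b {0}) (≢-sym (<⇒≢ r<b))) (runL X (duplicate r b) U))
          (duplicate-moves₀ r<b U)

  copy-restores : ∀ {r b} → r < b → ∀ U → runL X (copy r b) U r ≡ U r
  copy-restores {r} {b} r<b U =
    trans (addTo-moves X (m<n⇒m≢o+n 1 r<b) (runL X (duplicate r b) U) (duplicate-empties r<b U))
          (duplicate-moves₁ r<b U)

  copy-preserves : ∀ {r b j} → r < b → j < b → Preserves X (copy r b) j
  copy-preserves {r} {b} {j} r<b j<b with j ≟ r
  ... | no j≢r =
    preserves-⨾ X (preserves-⨾ X (preserves-clear X (<⇒≢ j<b)) (preserves-⨾ X (preserves-clear X (m<n⇒m≢o+n 1 j<b))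
      (preserves-loop X j≢r (preserves-⨾ X (preserves-incL X (<⇒≢ j<b)) (preserves-incL X (m<n⇒m≢o+n 1 j<b))))))
      (preserves-addTo X (m<n⇒m≢o+n 1 j<b) j≢r)
  ... | yes refl = preserving (copy-restores r<b)

  bindStep-below : ∀ {n} {env : Fin n → ℕ} {b} → (∀ i → env i < b) → ∀ i → bindStep env b i < 3 + b
  bindStep-below {b = b} env<b zero = m<n⇒m<1+n (n<1+n (suc b))
  bindStep-below {b = b} env<b (suc zero) = n<1+n (suc (suc b))
  bindStep-below env<b (suc (suc i)) = m<n⇒m<1+n (m<n⇒m<1+n (m<n⇒m<1+n (env<b i)))

  mutual
    compile-preserves : ∀ {n} (e : Expr n) {env b} → (∀ i → env i < b) →
      ∀ {j} → j < b → Preserves X (compile e env b) j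
    compile-preserves (var i)    env<b j<b = copy-preserves (env<b i) j<b
    compile-preserves zer        env<b j<b = preserves-clear X (<⇒≢ j<b)
    compile-preserves (sc e)     env<b j<b = preserves-⨾ X (compile-preserves e env<b j<b) (preserves-incL X (<⇒≢ j<b))
    compile-preserves (oracle e) env<b j<b = preserves-⨾ X (compile-preserves e env<b j<b) (preserves-orcL X (<⇒≢ j<b))
    compile-preserves (rec c z s) env<b j<b =
      preserves-⨾ X (compile-preserves c env<b j<b)
        (preserves-⨾ X (compile-preserves z (λ i → m<n⇒m<1+n (env<b i)) (m<n⇒m<1+n j<b))
          (preserves-⨾ X (preserves-clear X (m<n⇒m≢o+n 2 j<b))
            (preserves-⨾ X (preserves-loop X (<⇒≢ j<b)
                             (recStep-preserves s env<b (<-≤-trans j<b (m≤n+m _ 3)) (m<n⇒m≢o+n 1 j<b) (m<n⇒m≢o+n 2 j<b)))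
              (preserves-addTo X (m<n⇒m≢o+n 1 j<b) (<⇒≢ j<b)))))

    recStep-preserves : ∀ {n} (s : Expr (suc (suc n))) {env b} → (∀ i → env i < b) →
      ∀ {j} → j < 3 + b → j ≢ 1 + b → j ≢ 2 + b → Preserves X (recStep s env b) j
    recStep-preserves s env<b j<3+b j≢1+b j≢2+b =
      preserves-⨾ X (compile-preserves s (bindStep-below env<b) j<3+b)
        (preserves-⨾ X (preserves-clear X j≢1+b)
          (preserves-⨾ X (preserves-addTo X (<⇒≢ j<3+b) j≢1+b) (preserves-incL X j≢2+b)))

  open Eval X

  Agrees : ∀ {n} → (Fin n → ℕ) → Regs → Vec ℕ n → Set
  Agrees env U ρ = ∀ i → U (env i) ≡ lookup ρ i

  agrees-preserved : ∀ {n} {env : Fin n → ℕ} {b p U ρ} → (∀ i → env i < b) →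
    (∀ {j} → j < b → Preserves X p j) → Agrees env U ρ → Agrees env (runL X p U) ρ
  agrees-preserved {U = U} env<b pres agree i = trans (preserved (pres (env<b i)) U) (agree i)

  mutual
    compile-correct : ∀ {n} (e : Expr n) {env b} → (∀ i → env i < b) →
      ∀ {U ρ} → Agrees env U ρ → runL X (compile e env b) U b ≡ eval e ρ
    compile-correct (var i)     env<b {U} agree = trans (copy-copies (env<b i) U) (agree i)
    compile-correct zer         {b = b} env<b {U} agree = clear-clears X b U
    compile-correct (sc e)      {env} {b} env<b {U} agree =
      trans (incL-increments X b (runL X (compile e env b) U)) (cong suc (compile-correct e env<b agree))
    compile-correct (oracle e)  {env} {b} env<b {U} agree =
      trans (set-hit (runL X (compile e env b) U) b _) (cong (λ v → bit (X v)) (compile-correct e env<b agree))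
    compile-correct (rec c z s) env<b agree = compile-rec-correct c z s env<b agree

    RecInvariant : ∀ {n} → Expr n → Expr (suc (suc n)) → (Fin n → ℕ) → ℕ → Vec ℕ n → ℕ → Regs → Set
    RecInvariant z s env b ρ j V =
      V (1 + b) ≡ natrec j (eval z ρ) (λ a i → eval s (a ∷ i ∷ ρ)) × V (2 + b) ≡ j × Agrees env V ρ

    recStep-invariant : ∀ {n} (z : Expr n) s {env b} → (∀ i → env i < b) → ∀ {ρ j V} →
      RecInvariant z s env b ρ j V → RecInvariant z s env b ρ (suc j) (runL X (recStep s env b) V)
    recStep-invariant z s {env} {b} env<b {ρ} {j} {V} (acc , index , agree) =
      accumulated , indexed ,
      agrees-preserved {p = recStep s env b} {ρ = ρ} env<b
        (λ j<b → recStep-preserves s env<b (<-≤-trans j<b (m≤n+m b 3)) (m<n⇒m≢o+n 1 j<b) (m<n⇒m≢o+n 2 j<b)) agree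
      where
      V₁ : Regs
      V₁ = runL X (compile s (bindStep env b) (3 + b)) V
      V₂ : Regs
      V₂ = runL X (clear (1 + b)) V₁
      V₃ : Regs
      V₃ = runL X (addTo (3 + b) (1 + b)) V₂
      stepAgrees : Agrees (bindStep env b) V (V (1 + b) ∷ V (2 + b) ∷ ρ)
      stepAgrees zero          = refl
      stepAgrees (suc zero)    = refl
      stepAgrees (suc (suc i)) = agree i
      accumulated : runL X (incL (2 + b)) V₃ (1 + b) ≡ natrec (suc j) (eval z ρ) (λ a i → eval s (a ∷ i ∷ ρ))
      accumulated = begin
        runL X (incL (2 + b)) V₃ (1 + b)   ≡⟨ preserved (preserves-incL X (m≢1+n+m (1 + b) {0})) V₃ ⟩
        V₃ (1 + b)                         ≡⟨ addTo-moves X (m≢1+n+m (1 + b) {1}) V₂ (clear-clears X (1 + b) V₁) ⟩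
        V₂ (3 + b)                         ≡⟨ preserved (preserves-clear X (≢-sym (m≢1+n+m (1 + b) {1}))) V₁ ⟩
        V₁ (3 + b)                         ≡⟨ compile-correct s (bindStep-below env<b) stepAgrees ⟩
        eval s (V (1 + b) ∷ V (2 + b) ∷ ρ) ≡⟨ cong₂ (λ a i → eval s (a ∷ i ∷ ρ)) acc index ⟩
        natrec (suc j) (eval z ρ) (λ a i → eval s (a ∷ i ∷ ρ)) ∎
        where open ≡-Reasoning
      indexed : runL X (incL (2 + b)) V₃ (2 + b) ≡ suc j
      indexed = trans (incL-increments X (2 + b) V₃) (cong suc (begin
        V₃ (2 + b) ≡⟨ preserved (preserves-addTo X (m≢1+n+m (2 + b) {0}) (≢-sym (m≢1+n+m (1 + b) {0}))) V₂ ⟩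
        V₂ (2 + b) ≡⟨ preserved (preserves-clear X (≢-sym (m≢1+n+m (1 + b) {0}))) V₁ ⟩
        V₁ (2 + b) ≡⟨ preserved (compile-preserves s (bindStep-below env<b) (n<1+n (2 + b))) V ⟩
        V (2 + b)  ≡⟨ index ⟩
        j          ∎))
        where open ≡-Reasoning

    recSetup : ∀ {n} (c z : Expr n) (s : Expr (suc (suc n))) {env b} → (∀ i → env i < b) →
      ∀ {U ρ} → Agrees env U ρ →
      let W₀ = runL X (compile c env b ⨾ compile z env (1 + b) ⨾ clear (2 + b)) U
      in W₀ b ≡ eval c ρ × RecInvariant z s env b ρ 0 (set W₀ b 0)
    recSetup c z s {env} {b} env<b {U} {ρ} agree = counter , accumulator , index , agree₀
      where
      below-1+b : ∀ i → env i < 1 + b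
      below-1+b i = m<n⇒m<1+n (env<b i)
      U₁ : Regs
      U₁ = runL X (compile c env b) U
      U₂ : Regs
      U₂ = runL X (compile z env (1 + b)) U₁
      W₀ : Regs
      W₀ = runL X (clear (2 + b)) U₂
      agree₁ : Agrees env U₁ ρ
      agree₁ = agrees-preserved {ρ = ρ} env<b (compile-preserves c env<b) agree
      counter : W₀ b ≡ eval c ρ
      counter = begin
        W₀ b ≡⟨ preserved (preserves-clear X (m≢1+n+m b {1})) U₂ ⟩
        U₂ b ≡⟨ preserved (compile-preserves z below-1+b (n<1+n b)) U₁ ⟩
        U₁ b ≡⟨ compile-correct c env<b agree ⟩
        eval c ρ ∎
        where open ≡-Reasoning
      accumulator : set W₀ b 0 (1 + b) ≡ eval z ρ
      accumulator = trans (set-miss W₀ b 0 (≢-sym (m≢1+n+m b {0})))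
        (trans (preserved (preserves-clear X (m≢1+n+m (1 + b) {0})) U₂) (compile-correct z below-1+b agree₁))
      index : set W₀ b 0 (2 + b) ≡ 0
      index = trans (set-miss W₀ b 0 (≢-sym (m≢1+n+m b {1}))) (clear-clears X (2 + b) U₂)
      agree₀ : Agrees env (set W₀ b 0) ρ
      agree₀ i = trans (set-miss W₀ b 0 (<⇒≢ (env<b i)))
        (agrees-preserved {p = compile z env (1 + b) ⨾ clear (2 + b)} {ρ = ρ} env<b
          (λ j<b → preserves-⨾ X (compile-preserves z below-1+b (m<n⇒m<1+n j<b)) (preserves-clear X (m<n⇒m≢o+n 2 j<b)))
          agree₁ i)

    compile-rec-correct : ∀ {n} c z (s : Expr (suc (suc n))) {env b} → (∀ i → env i < b) →
      ∀ {U ρ} → Agrees env U ρ → runL X (compile (rec c z s) env b) U b ≡ eval (rec c z s) ρ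
    compile-rec-correct c z s {env} {b} env<b {U} {ρ} agree = begin
      runL X (addTo (1 + b) b) W b   ≡⟨ addTo-moves X (m≢1+n+m b {0}) W (loop-clears X (recStep s env b) b-untouched W₀) ⟩
      W (1 + b)                      ≡⟨ proj₁ final ⟩
      natrec (W₀ b) (eval z ρ) f     ≡⟨ cong (λ v → natrec v (eval z ρ) f) (proj₁ setup) ⟩
      eval (rec c z s) ρ             ∎
      where
      open ≡-Reasoning
      f : ℕ → ℕ → ℕ
      f a i = eval s (a ∷ i ∷ ρ)
      W₀ : Regs
      W₀ = runL X (compile c env b ⨾ compile z env (1 + b) ⨾ clear (2 + b)) U
      W : Regs
      W = runL X (loop b (recStep s env b)) W₀
      setup : W₀ b ≡ eval c ρ × RecInvariant z s env b ρ 0 (set W₀ b 0)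
      setup = recSetup c z s env<b agree
      final : RecInvariant z s env b ρ (W₀ b) W
      final = iter-invariant (runL X (recStep s env b)) (RecInvariant z s env b ρ)
        (λ j V → recStep-invariant z s env<b) (W₀ b) (set W₀ b 0) (proj₂ setup)
      b-untouched : Preserves X (recStep s env b) b
      b-untouched = recStep-preserves s env<b (m≤n+m (1 + b) 2) (m≢1+n+m b {0}) (m≢1+n+m b {1})

-- Compiling LOOP programs to register machines

set-cong : ∀ {U V} r v → U ≗ V → set U r v ≗ set V r v
set-cong {U} {V} r v U≗V i with i ≡ᵇ r
... | true  = refl
... | false = U≗V i

iter-cong : ∀ (f : Regs → Regs) → (∀ {U V} → U ≗ V → f U ≗ f V) →
  ∀ n {U V} → U ≗ V → iter n f U ≗ iter n f V
iter-cong f f-cong zero    U≗V = U≗V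
iter-cong f f-cong (suc n) U≗V = iter-cong f f-cong n (f-cong U≗V)

runL-cong : ∀ X p {U V} → U ≗ V → runL X p U ≗ runL X p V
runL-cong X skip       U≗V = U≗V
runL-cong X (incL r)   {U} {V} U≗V i = trans (set-cong r _ U≗V i) (cong (λ v → set V r (suc v) i) (U≗V r))
runL-cong X (orcL r)   {U} {V} U≗V i = trans (set-cong r _ U≗V i) (cong (λ v → set V r (bit (X v)) i) (U≗V r))
runL-cong X (p ⨾ q)    U≗V = runL-cong X q (runL-cong X p U≗V)
runL-cong X (loop r p) {U} {V} U≗V i rewrite U≗V r = iter-cong (runL X p) (runL-cong X p) (V r) (set-cong r 0 U≗V) i

-- Register layout of the compiled machine: LOOP register r lives in 2r, register 1 stays 0
-- (so  decjz zeroReg j  is an unconditional jump), and the loop at nesting depth d counts in 2d + 3.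
user : ℕ → ℕ
user r = 2 * r

zeroReg : ℕ
zeroReg = 1

counter : ℕ → ℕ
counter d = suc (2 * suc d)

user-injective : ∀ i j → user i ≡ user j → i ≡ j
user-injective i j = *-cancelˡ-≡ i j 2

zeroReg≢user : ∀ i → zeroReg ≢ user i
zeroReg≢user i e = even≢odd i 0 (sym e)

counter≢user : ∀ d i → counter d ≢ user i
counter≢user d i e = even≢odd i (suc d) (sym e)

counter≢zeroReg : ∀ d → counter d ≢ zeroReg
counter≢zeroReg d e = 0≢1+n (sym (suc-injective e))

counter-injective : ∀ d d' → counter d ≡ counter d' → d ≡ d'
counter-injective d d' e = suc-injective (*-cancelˡ-≡ (suc d) (suc d') 2 (suc-injective e))

users : Regs → Regs
users R i = R (user i)

set-user : ∀ R r v → users (set R (user r) v) ≗ set (users R) r v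
set-user R r v i with i ≟ r
... | yes refl = trans (set-hit R (user r) v) (sym (set-hit (users R) r v))
... | no i≢r   = trans (set-miss R (user r) v (λ e → i≢r (user-injective i r e))) (sym (set-miss (users R) r v i≢r))

-- Clear the counter (addresses o, o+1), move register r into it (o+2 … o+4), then
-- run the body B once per unit of the counter (o+5 … ).
loopCode : ℕ → ℕ → ℕ → List Instr → List Instr
loopCode d o r B =
  decjz (counter d) (2 + o) ∷ decjz zeroReg o ∷
  decjz (user r) (5 + o) ∷ inc (counter d) ∷ decjz zeroReg (2 + o) ∷
  decjz (counter d) (7 + (length B + o)) ∷ (B ++ᴸ decjz zeroReg (5 + o) ∷ [])

-- Jumps are absolute, so the code depends on its address o; d is the loop nesting depth.
compileL : ℕ → ℕ → Loop → List Instr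
compileL d o skip       = []
compileL d o (incL r)   = inc (user r) ∷ []
compileL d o (orcL r)   = orc (user r) ∷ []
compileL d o (p ⨾ q)    = compileL d o p ++ᴸ compileL d (length (compileL d o p) + o) q
compileL d o (loop r p) = loopCode d o r (compileL (suc d) (6 + o) p)

CodeAt : OracleMachine → ℕ → List Instr → Set
CodeAt M o []      = ⊤
CodeAt M o (ι ∷ c) = nth M o ≡ just ι × CodeAt M (suc o) c

CodeAt-++ : ∀ M o c₁ c₂ → CodeAt M o (c₁ ++ᴸ c₂) → CodeAt M o c₁ × CodeAt M (length c₁ + o) c₂
CodeAt-++ M o []       c₂ at = tt , at
CodeAt-++ M o (ι ∷ c₁) c₂ (here , at) with CodeAt-++ M (suc o) c₁ c₂ at
... | at₁ , at₂ = (here , at₁) , subst (λ k → CodeAt M k c₂) (+-suc (length c₁) o) at₂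

module Machine (X : Cantor) (M : OracleMachine) where

  infix 4 _↝_
  _↝_ : Config → Config → Set
  c ↝ c' = ∃ λ k → run M X k c ≡ c'

  run-+ : ∀ k₁ k₂ c → run M X (k₁ + k₂) c ≡ run M X k₂ (run M X k₁ c)
  run-+ zero     k₂ c = refl
  run-+ (suc k₁) k₂ c = run-+ k₁ k₂ (step M X c)

  ↝-refl : ∀ {c} → c ↝ c
  ↝-refl = 0 , refl

  ↝-trans : ∀ {c c' c''} → c ↝ c' → c' ↝ c'' → c ↝ c''
  ↝-trans {c} (k₁ , e₁) (k₂ , e₂) = k₁ + k₂ , trans (run-+ k₁ k₂ c) (trans (cong (run M X k₂) e₁) e₂)

  step-executes : ∀ {c ι} → nth M (pc c) ≡ just ι → step M X c ≡ exec X ι c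
  step-executes here rewrite here = refl

  ↝-step : ∀ {o R ι c} → nth M o ≡ just ι → exec X ι (cfg o R) ≡ c → cfg o R ↝ c
  ↝-step here e = 1 , trans (step-executes here) e

  decjz-zero : ∀ {r j p R} → R r ≡ 0 → exec X (decjz r j) (cfg p R) ≡ cfg j R
  decjz-zero {r} {R = R} e with R r
  ... | zero = refl

  decjz-suc : ∀ {r j p R v} → R r ≡ suc v → exec X (decjz r j) (cfg p R) ≡ cfg (suc p) (set R r v)
  decjz-suc {r} {R = R} e with R r
  decjz-suc refl | suc v = refl

  record Follows (p : Loop) (d : ℕ) (R R' : Regs) : Set where
    field
      zeroReg-kept  : R' zeroReg ≡ 0
      users-run     : users R' ≗ runL X p (users R)
      counters-kept : ∀ j → j < d → R' (counter j) ≡ R (counter j)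
  open Follows

  Simulates : Loop → ℕ → ℕ → Set
  Simulates p d o = CodeAt M o (compileL d o p) → ∀ R → R zeroReg ≡ 0 →
    ∃ λ R' → cfg o R ↝ cfg (length (compileL d o p) + o) R' × Follows p d R R'

  module LoopPhases (d o r : ℕ) (p : Loop) (at : CodeAt M o (loopCode d o r (compileL (suc d) (6 + o) p))) where
    C : ℕ
    C = counter d
    B : List Instr
    B = compileL (suc d) (6 + o) p

    at₀ : nth M o ≡ just (decjz C (2 + o))
    at₀ = proj₁ at
    at₁ : nth M (1 + o) ≡ just (decjz zeroReg o)
    at₁ = proj₁ (proj₂ at)
    at₂ : nth M (2 + o) ≡ just (decjz (user r) (5 + o))
    at₂ = proj₁ (proj₂ (proj₂ at))
    at₃ : nth M (3 + o) ≡ just (inc C)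
    at₃ = proj₁ (proj₂ (proj₂ (proj₂ at)))
    at₄ : nth M (4 + o) ≡ just (decjz zeroReg (2 + o))
    at₄ = proj₁ (proj₂ (proj₂ (proj₂ (proj₂ at))))
    at₅ : nth M (5 + o) ≡ just (decjz C (7 + (length B + o)))
    at₅ = proj₁ (proj₂ (proj₂ (proj₂ (proj₂ (proj₂ at)))))
    atBody : CodeAt M (6 + o) B × CodeAt M (length B + (6 + o)) (decjz zeroReg (5 + o) ∷ [])
    atBody = CodeAt-++ M (6 + o) B (decjz zeroReg (5 + o) ∷ []) (proj₂ (proj₂ (proj₂ (proj₂ (proj₂ (proj₂ at))))))
    atB : CodeAt M (6 + o) B
    atB = proj₁ atBody
    atBack : nth M (length B + (6 + o)) ≡ just (decjz zeroReg (5 + o))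
    atBack = proj₁ (proj₂ atBody)

    zeroReg≢C : zeroReg ≢ C
    zeroReg≢C = ≢-sym (counter≢zeroReg d)

    clearing : ∀ v R → R C ≡ v → R zeroReg ≡ 0 →
      ∃ λ R' → cfg o R ↝ cfg (2 + o) R' × R' C ≡ 0 × (∀ i → i ≢ C → R' i ≡ R i)
    clearing zero    R C≡0 z = R , ↝-step at₀ (decjz-zero C≡0) , C≡0 , λ _ _ → refl
    clearing (suc v) R C≡v z with clearing v (set R C v) (set-hit R C v) (trans (set-miss R C v zeroReg≢C) z)
    ... | R' , run , cleared , others =
      R' , ↝-trans (↝-trans (↝-step at₀ (decjz-suc C≡v))
                           (↝-step at₁ (decjz-zero (trans (set-miss R C v zeroReg≢C) z)))) run ,
      cleared , λ i i≢C → trans (others i i≢C) (set-miss R C v i≢C)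

    transferUnit : ℕ → Regs → Regs
    transferUnit a R = set (set R (user r) a) C (suc (set R (user r) a C))

    transferUnit-user : ∀ a R → transferUnit a R (user r) ≡ a
    transferUnit-user a R = trans (set-miss (set R (user r) a) C _ (≢-sym (counter≢user d r))) (set-hit R (user r) a)

    transferUnit-counter : ∀ a R → transferUnit a R C ≡ suc (R C)
    transferUnit-counter a R = trans (set-hit (set R (user r) a) C _) (cong suc (set-miss R (user r) a (counter≢user d r)))

    transferUnit-other : ∀ a R {i} → i ≢ C → i ≢ user r → transferUnit a R i ≡ R i
    transferUnit-other a R i≢C i≢r = trans (set-miss (set R (user r) a) C _ i≢C) (set-miss R (user r) a i≢r)

    transferring : ∀ a R → R (user r) ≡ a → R zeroReg ≡ 0 →
      ∃ λ R' → cfg (2 + o) R ↝ cfg (5 + o) R' × R' (user r) ≡ 0 × R' C ≡ a + R C ×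
               (∀ i → i ≢ C → i ≢ user r → R' i ≡ R i)
    transferring zero    R r≡0 z = R , ↝-step at₂ (decjz-zero r≡0) , r≡0 , refl , λ _ _ _ → refl
    transferring (suc a) R r≡1+a z
      with transferring a (transferUnit a R) (transferUnit-user a R) (trans (transferUnit-other a R zeroReg≢C (zeroReg≢user r)) z)
    ... | R' , run , emptied , C≡ , others =
      R' , ↝-trans (↝-trans (↝-trans (↝-step at₂ (decjz-suc r≡1+a)) (↝-step at₃ refl))
                           (↝-step at₄ (decjz-zero (trans (transferUnit-other a R zeroReg≢C (zeroReg≢user r)) z)))) run ,
      emptied , trans C≡ (trans (cong (a +_) (transferUnit-counter a R)) (+-suc a (R C))) ,
      λ i i≢C i≢r → trans (others i i≢C i≢r) (transferUnit-other a R i≢C i≢r)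

    iterating : Simulates p (suc d) (6 + o) → ∀ n R → R C ≡ n → R zeroReg ≡ 0 →
      ∃ λ R' → cfg (5 + o) R ↝ cfg (7 + (length B + o)) R' × R' zeroReg ≡ 0 ×
               users R' ≗ iter n (runL X p) (users R) × (∀ j → j < d → R' (counter j) ≡ R (counter j))
    iterating body zero R C≡0 z = R , ↝-step at₅ (decjz-zero C≡0) , z , (λ _ → refl) , λ _ _ → refl
    iterating body (suc n) R C≡1+n z
      with body atB (set R C n) (trans (set-miss R C n zeroReg≢C) z)
    ... | R₁ , run₁ , follows
      with iterating body n R₁ (trans (counters-kept follows d (n<1+n d)) (set-hit R C n)) (zeroReg-kept follows)
    ... | R₂ , run₂ , z₂ , users₂ , kept₂ =
      R₂ , ↝-trans (↝-trans (↝-trans (↝-step at₅ (decjz-suc C≡1+n)) run₁)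
                           (↝-step atBack (decjz-zero (zeroReg-kept follows)))) run₂ ,
      z₂ ,
      (λ i → trans (users₂ i) (iter-cong (runL X p) (runL-cong X p) n
        (λ j → trans (users-run follows j) (runL-cong X p (λ k → set-miss R C n (≢-sym (counter≢user d k))) j)) i)) ,
      λ j j<d → trans (kept₂ j j<d) (trans (counters-kept follows j (m<n⇒m<1+n j<d))
                                           (set-miss R C n (λ e → <⇒≢ j<d (counter-injective j d e))))

    runs-loop : Simulates p (suc d) (6 + o) → ∀ R → R zeroReg ≡ 0 →
      ∃ λ R' → cfg o R ↝ cfg (7 + (length B + o)) R' × Follows (loop r p) d R R'
    runs-loop body R z with clearing (R C) R refl z
    ... | R₁ , run₁ , C₁ , others₁ with transferring (R₁ (user r)) R₁ refl (trans (others₁ zeroReg zeroReg≢C) z)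
    ... | R₂ , run₂ , emptied , C₂ , others₂
      with iterating body (R₂ C) R₂ refl
             (trans (others₂ zeroReg zeroReg≢C (zeroReg≢user r)) (trans (others₁ zeroReg zeroReg≢C) z))
    ... | R₃ , run₃ , z₃ , users₃ , kept₃ = R₃ , ↝-trans (↝-trans run₁ run₂) run₃ , record
      { zeroReg-kept  = z₃
      ; users-run     = λ i → trans (users₃ i) (trans (cong (λ n → iter n (runL X p) (users R₂) i) counted)
                                (iter-cong (runL X p) (runL-cong X p) (R (user r)) users₂ i))
      ; counters-kept = λ j j<d → trans (kept₃ j j<d)
          (trans (others₂ (counter j) (counter≢C j<d) (counter≢user j r)) (others₁ (counter j) (counter≢C j<d))) }
      where
      counter≢C : ∀ {j} → j < d → counter j ≢ C
      counter≢C j<d e = <⇒≢ j<d (counter-injective _ d e)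
      counted : R₂ C ≡ R (user r)
      counted = trans C₂ (trans (cong (R₁ (user r) +_) C₁)
                  (trans (+-identityʳ _) (others₁ (user r) (≢-sym (counter≢user d r)))))
      users₂ : users R₂ ≗ set (users R) r 0
      users₂ j with j ≟ r
      ... | yes refl = trans emptied (sym (set-hit (users R) r 0))
      ... | no j≢r = trans (others₂ (user j) (≢-sym (counter≢user d j)) (λ e → j≢r (user-injective j r e)))
                       (trans (others₁ (user j) (≢-sym (counter≢user d j))) (sym (set-miss (users R) r 0 j≢r)))

  simulate : ∀ p d o → Simulates p d o
  simulate skip d o at R z = R , ↝-refl , record { zeroReg-kept = z ; users-run = λ _ → refl ; counters-kept = λ _ _ → refl }
  simulate (incL r) d o (here , _) R z =
    set R (user r) (suc (R (user r))) , ↝-step here refl , record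
      { zeroReg-kept  = trans (set-miss R (user r) _ (zeroReg≢user r)) z
      ; users-run     = set-user R r _
      ; counters-kept = λ j _ → set-miss R (user r) _ (counter≢user j r) }
  simulate (orcL r) d o (here , _) R z =
    set R (user r) (bit (X (R (user r)))) , ↝-step here refl , record
      { zeroReg-kept  = trans (set-miss R (user r) _ (zeroReg≢user r)) z
      ; users-run     = set-user R r _
      ; counters-kept = λ j _ → set-miss R (user r) _ (counter≢user j r) }
  simulate (p ⨾ q) d o at R z
    with CodeAt-++ M o (compileL d o p) (compileL d (length (compileL d o p) + o) q) at
  ... | at-p , at-q with simulate p d o at-p R z
  ... | R₁ , run₁ , follows₁ with simulate q d (length (compileL d o p) + o) at-q R₁ (zeroReg-kept follows₁)
  ... | R₂ , run₂ , follows₂ =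
    R₂ , subst (λ k → cfg o R ↝ cfg k R₂) end (↝-trans run₁ run₂) , record
      { zeroReg-kept  = zeroReg-kept follows₂
      ; users-run     = λ i → trans (users-run follows₂ i) (runL-cong X q (users-run follows₁) i)
      ; counters-kept = λ j j<d → trans (counters-kept follows₂ j j<d) (counters-kept follows₁ j j<d) }
    where
    cp : List Instr
    cp = compileL d o p
    cq : List Instr
    cq = compileL d (length cp + o) q
    end : length cq + (length cp + o) ≡ length (cp ++ᴸ cq) + o
    end = trans (sym (+-assoc (length cq) (length cp) o))
                (cong (_+ o) (trans (+-comm (length cq) (length cp)) (sym (length-++ cp))))
  simulate (loop r p) d o at =
    subst (λ k → ∀ R → R zeroReg ≡ 0 → ∃ λ R' → cfg o R ↝ cfg k R' × Follows (loop r p) d R R') end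
      (LoopPhases.runs-loop d o r p at (simulate p (suc d) (6 + o)))
    where
    B : List Instr
    B = compileL (suc d) (6 + o) p
    end : 7 + (length B + o) ≡ length (compileL d o (loop r p)) + o
    end = cong (6 +_) (sym (trans (cong (_+ o) (length-++ B)) (trans (+-assoc (length B) 1 o) (+-suc (length B) o))))

-- The search machine

-- Run at address L, after the program has left its value in LOOP register 2:
-- halt if it is nonzero, otherwise increment LOOP register 1 and start again.
searchTail : ℕ → List Instr
searchTail L = decjz (user 2) (2 + L) ∷ decjz zeroReg (4 + L) ∷ inc (user 1) ∷ decjz zeroReg 0 ∷ []

searchMachine : Loop → OracleMachine
searchMachine P = compileL 0 0 P ++ᴸ searchTail (length (compileL 0 0 P))

CodeAt-cons : ∀ ι M o c → CodeAt M o c → CodeAt (ι ∷ M) (suc o) c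
CodeAt-cons ι M o []      _          = tt
CodeAt-cons ι M o (κ ∷ c) (here , at) = here , CodeAt-cons ι M (suc o) c at

CodeAt-self : ∀ c → CodeAt c 0 c
CodeAt-self []      = tt
CodeAt-self (ι ∷ c) = refl , CodeAt-cons ι c 0 c (CodeAt-self c)

nth-++ : ∀ {A : Set} (c d : List A) i → nth (c ++ᴸ d) (length c + i) ≡ nth d i
nth-++ []      d i = refl
nth-++ (x ∷ c) d i = nth-++ c d i

nth-++-∷ : ∀ {A : Set} (c : List A) x d → nth (c ++ᴸ x ∷ d) 0 ≢ nothing
nth-++-∷ []      x d ()
nth-++-∷ (y ∷ c) x d ()

module Search (X : Cantor) (P : Loop) (f : ℕ → ℕ → ℕ)
  (computes : ∀ U → runL X P U 2 ≡ f (U 0) (U 1))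
  (keeps-input : Preserves X P 0) (keeps-candidate : Preserves X P 1) where

  M : OracleMachine
  M = searchMachine P
  L : ℕ
  L = length (compileL 0 0 P)
  open Machine X M

  atP : CodeAt M 0 (compileL 0 0 P)
  atP = proj₁ (CodeAt-++ M 0 (compileL 0 0 P) (searchTail L) (CodeAt-self M))
  atTail : CodeAt M L (searchTail L)
  atTail = subst (λ o → CodeAt M o (searchTail L)) (+-identityʳ L)
                 (proj₂ (CodeAt-++ M 0 (compileL 0 0 P) (searchTail L) (CodeAt-self M)))
  at₀ : nth M L ≡ just (decjz (user 2) (2 + L))
  at₀ = proj₁ atTail
  at₁ : nth M (1 + L) ≡ just (decjz zeroReg (4 + L))
  at₁ = proj₁ (proj₂ atTail)
  at₂ : nth M (2 + L) ≡ just (inc (user 1))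
  at₂ = proj₁ (proj₂ (proj₂ atTail))
  at₃ : nth M (3 + L) ≡ just (decjz zeroReg 0)
  at₃ = proj₁ (proj₂ (proj₂ (proj₂ atTail)))

  Searching : ℕ → ℕ → Regs → Set
  Searching n j R = R zeroReg ≡ 0 × R (user 0) ≡ n × R (user 1) ≡ j

  evaluates : ∀ {n j R} → Searching n j R →
    ∃ λ R' → cfg 0 R ↝ cfg L R' × Searching n j R' × R' (user 2) ≡ f n j
  evaluates {n} {j} {R} (z , input , candidate) with simulate P 0 0 atP R z
  ... | R' , path , follows =
    R' , subst (λ o → cfg 0 R ↝ cfg o R') (+-identityʳ L) path , (zeroReg-kept , input' , candidate') , value
    where
    open Follows follows
    input' : R' (user 0) ≡ n
    input' = trans (users-run 0) (trans (preserved keeps-input (users R)) input)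
    candidate' : R' (user 1) ≡ j
    candidate' = trans (users-run 1) (trans (preserved keeps-candidate (users R)) candidate)
    value : R' (user 2) ≡ f n j
    value = trans (users-run 2) (trans (computes (users R)) (cong₂ f input candidate))

  Halts : Config → Set
  Halts c = ∃ λ t → Halted M (run M X t c)

  halted-end : ∀ {R} → Halted M (cfg (4 + L) R)
  halted-end = trans (cong (nth M) (+-comm 4 L)) (nth-++ (compileL 0 0 P) (searchTail L) 4)

  halts-on-nonzero : ∀ {n j R w} → Searching n j R → f n j ≡ suc w → Halts (cfg 0 R)
  halts-on-nonzero {n} {j} {R} {w} searching f≡1+w with evaluates searching
  ... | R₁ , run₁ , (z₁ , _) , value = proj₁ path , subst (Halted M) (sym (proj₂ path)) (halted-end {set R₁ (user 2) w})
    where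
    path : cfg 0 R ↝ cfg (4 + L) (set R₁ (user 2) w)
    path = ↝-trans run₁ (↝-trans (↝-step at₀ (decjz-suc (trans value f≡1+w)))
                                (↝-step at₁ (decjz-zero (trans (set-miss R₁ (user 2) w (zeroReg≢user 2)) z₁))))

  next-candidate : ∀ {n j R} → Searching n j R → f n j ≡ 0 →
    ∃ λ R' → ∃ λ t → run M X (suc t) (cfg 0 R) ≡ cfg 0 R' × Searching n (suc j) R'
  next-candidate {n} {j} {R} searching f≡0 with evaluates searching
  ... | R₁ , (k , path₁) , (z₁ , input₁ , candidate₁) , value =
    R' , k + 2 , trans (cong (λ t → run M X t (cfg 0 R)) (sym (+-suc k 2))) (proj₂ path) ,
    z' , trans (set-miss R₁ (user 1) (suc (R₁ (user 1))) (λ e → 0≢1+n (user-injective 0 1 e))) input₁ ,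
    trans (set-hit R₁ (user 1) (suc (R₁ (user 1)))) (cong suc candidate₁)
    where
    R' : Regs
    R' = set R₁ (user 1) (suc (R₁ (user 1)))
    z' : R' zeroReg ≡ 0
    z' = trans (set-miss R₁ (user 1) (suc (R₁ (user 1))) (zeroReg≢user 1)) z₁
    path : cfg 0 R ↝ cfg 0 R'
    path = ↝-trans (k , path₁) (↝-trans (↝-step at₀ (decjz-zero (trans value f≡0)))
             (↝-trans (↝-step at₂ refl) (↝-step at₃ (decjz-zero z'))))

  halts-if : ∀ d {n j R} → Searching n j R → f n (d + j) ≢ 0 → Halts (cfg 0 R)
  halts-if d {n} {j} searching f≢0 with f n j in f≡
  ... | suc w = halts-on-nonzero searching f≡
  halts-if zero    searching f≢0 | zero = ⊥-elim (f≢0 f≡)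
  halts-if (suc d) {n} {j} {R} searching f≢0 | zero with next-candidate searching f≡
  ... | R' , t , path , searching' with halts-if d searching' (subst (λ i → f n i ≢ 0) (sym (+-suc d j)) f≢0)
  ... | t' , halted = suc t + t' , subst (Halted M) (sym (trans (run-+ (suc t) t' (cfg 0 R)) (cong (run M X t') path))) halted

  stays-halted : ∀ c → Halted M c → ∀ t → run M X t c ≡ c
  stays-halted c halted zero    = refl
  stays-halted c halted (suc t) rewrite halted = stays-halted c halted t

  keeps-searching : ∀ n → (∀ s → f n s ≡ 0) → ∀ j →
    ∃ λ t → j ≤ t × ∃ λ R → run M X t (initial n) ≡ cfg 0 R × Searching n j R
  keeps-searching n f≡0 zero = 0 , z≤n , regs (initial n) , refl , refl , refl , refl
  keeps-searching n f≡0 (suc j) with keeps-searching n f≡0 j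
  ... | t , j≤t , R , path , searching with next-candidate searching (f≡0 j)
  ... | R' , t' , path' , searching' =
    t + suc t' , ≤-trans (s≤s j≤t) (≤-trans (s≤s (m≤m+n t t')) (≤-reflexive (sym (+-suc t t')))) , R' ,
    trans (run-+ t (suc t') (initial n)) (trans (cong (run M X (suc t')) path) path') , searching'

  -- A halted configuration stays put, yet arbitrarily late runs are back at address 0.
  never-halts : ∀ n → (∀ s → f n s ≡ 0) → ¬ Halts (initial n)
  never-halts n f≡0 (t , halted) with keeps-searching n f≡0 t
  ... | t' , t≤t' , R , path , _ = start-not-halted (subst (λ c → Halted M c) at-start halted)
    where
    at-start : run M X t (initial n) ≡ cfg 0 R
    at-start = trans (sym (stays-halted (run M X t (initial n)) halted (t' ∸ t)))
      (trans (sym (run-+ t (t' ∸ t) (initial n))) (trans (cong (λ k → run M X k (initial n)) (m+[n∸m]≡n t≤t')) path))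
    start-not-halted : ¬ Halted M (cfg 0 R)
    start-not-halted = nth-++-∷ (compileL 0 0 P) _ _

  converges-if : ∀ {n} s → f n s ≢ 0 → Converges M X n
  converges-if {n} s f≢0 with halts-if s {j = 0} (refl , refl , refl) (subst (λ i → f n i ≢ 0) (sym (+-identityʳ s)) f≢0)
  ... | t , halted = regs (run M X t (initial n)) 0 , t , halted , refl

  diverges-if : ∀ {n} → (∀ s → f n s ≡ 0) → ¬ Converges M X n
  diverges-if {n} f≡0 (_ , t , halted , _) = never-halts n f≡0 (t , halted)

inputs : Fin 2 → ℕ
inputs zero       = 0
inputs (suc zero) = 1

inputs<2 : ∀ i → inputs i < 2
inputs<2 zero       = s≤s z≤n
inputs<2 (suc zero) = s≤s (s≤s z≤n)

refutationSearch : (k l : ℕ) → Δ₀ (l + (k + 1)) → OracleMachine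
refutationSearch k l θ = searchMachine (compile (refutedE k l θ) inputs 2)

inputs-agree : ∀ X U → Agrees X inputs U (U 0 ∷ U 1 ∷ [])
inputs-agree X U zero       = refl
inputs-agree X U (suc zero) = refl

-- The environment and target register are given explicitly: left to unification, they make
-- Agda normalise the whole compiled program.
compiled-refutedE-computes : ∀ k l θ X U →
  runL X (compile (refutedE k l θ) inputs 2) U 2 ≡ Eval.eval X (refutedE k l θ) (U 0 ∷ U 1 ∷ [])
compiled-refutedE-computes k l θ X U =
  compile-correct X (refutedE k l θ) {inputs} {2} inputs<2 {U} {U 0 ∷ U 1 ∷ []} (inputs-agree X U)

compiled-refutedE-keeps : ∀ k l θ X {j} → j < 2 → Preserves X (compile (refutedE k l θ) inputs 2) j
compiled-refutedE-keeps k l θ X j<2 = compile-preserves X (refutedE k l θ) {inputs} {2} inputs<2 j<2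

refutationSearch-domain : ExcludedMiddle 0ℓ → ∀ k l θ X n →
  Converges (refutationSearch k l θ) X n ⇔ ∃ (Refuted k l θ X n)
refutationSearch-domain em k l θ X n = mk⇔ refuted-if-converges converges-if-refuted
  where
  f : ℕ → ℕ → ℕ
  f n s = Eval.eval X (refutedE k l θ) (n ∷ s ∷ [])
  open Search X (compile (refutedE k l θ) inputs 2) f (compiled-refutedE-computes k l θ X)
    (compiled-refutedE-keeps k l θ X (s≤s z≤n)) (compiled-refutedE-keeps k l θ X (s≤s (s≤s z≤n)))
  indicates : ∀ s → Indicator (f n s) (Refuted k l θ X n s)
  indicates s = refutedE-indicates X k l θ n s
  converges-if-refuted : ∃ (Refuted k l θ X n) → Converges (refutationSearch k l θ) X n
  converges-if-refuted (s , refuted) =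
    converges-if s (λ f≡0 → 0≢1+n (trans (sym f≡0) (indicator-true (indicates s) refuted)))
  refuted-if-converges : Converges (refutationSearch k l θ) X n → ∃ (Refuted k l θ X n)
  refuted-if-converges converges = decidable-stable em λ ¬refuted →
    diverges-if (λ s → indicator-false (indicates s) (λ r → ¬refuted (s , r))) converges

total⇔everywhere : ∀ {M X} (R : ℕ → ℕ → Set) → (∀ n → Converges M X n ⇔ ∃ (R n)) →
  Total M X ⇔ (∀ n → ∃ (R n))
total⇔everywhere R domain =
  mk⇔ (λ total n → Equivalence.to (domain n) (total n)) (λ everywhere n → Equivalence.from (domain n) (everywhere n))

total⇔infiniteDomain : ∀ {M X} (R : ℕ → ℕ → Set) → (∀ n → Converges M X n ⇔ ∃ (R n)) →
  (∀ {n n' s} → n' ≤ n → R n s → R n' s) → Total M X ⇔ InfiniteDomain M X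
total⇔infiniteDomain R domain antitone = mk⇔ (λ total N → N , ≤-refl , total N) λ infinite n →
  let n' , n≤n' , converges = infinite n
      s , r = Equivalence.to (domain n') converges
  in Equivalence.from (domain n) (s , antitone n≤n' r)

-- Collection

Upward : (ℕ → Set) → Set
Upward P = ∀ {s s'} → s ≤ s' → P s → P s'

collect< : ∀ N (R : ℕ → ℕ → Set) → (∀ x → Upward (R x)) →
  (∀ x → x < N → ∃ (R x)) → ∃ λ s → ∀ x → x < N → R x s
collect< zero    R upward witness = 0 , λ x ()
collect< (suc N) R upward witness
  with collect< N R upward (λ x x<N → witness x (m<n⇒m<1+n x<N)) | witness N (n<1+n N)
... | s₁ , below | s₂ , at-N = s₁ ⊔ s₂ , λ x x<1+N → bounded x (m<1+n⇒m<n∨m≡n x<1+N)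
  where
  bounded : ∀ x → x < N ⊎ x ≡ N → R x (s₁ ⊔ s₂)
  bounded x (inj₁ x<N) = upward x (m≤m⊔n s₁ s₂) (below x x<N)
  bounded x (inj₂ refl) = upward x (m≤n⊔m s₁ s₂) at-N

collectAll : ∀ k N (R : Vec ℕ k → ℕ → Set) → (∀ xs → Upward (R xs)) →
  (∀ xs → All (_< N) xs → ∃ (R xs)) → ∃ λ s → ∀ xs → All (_< N) xs → R xs s
collectAll zero N R upward witness with witness [] []
... | s , r = s , λ { [] [] → r }
collectAll (suc k) N R upward witness
  with collectAll k N (λ ys s → ∀ x → x < N → R (x ∷ ys) s)
         (λ ys s≤s' below x x<N → upward (x ∷ ys) s≤s' (below x x<N))
         (λ ys ys<N → collect< N (λ x → R (x ∷ ys)) (λ x → upward (x ∷ ys))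
                                (λ x x<N → witness (x ∷ ys) (x<N ∷ ys<N)))
... | s , below = s , λ { (x ∷ ys) (x<N ∷ ys<N) → below ys ys<N x x<N }

max : ∀ {k} → Vec ℕ k → ℕ
max []       = 0
max (x ∷ xs) = x ⊔ max xs

All<-mono : ∀ {k} {xs : Vec ℕ k} {T T'} → T ≤ T' → All (_< T) xs → All (_< T') xs
All<-mono T≤T' = All.map (λ x<T → <-≤-trans x<T T≤T')

All<1+max : ∀ {k} (xs : Vec ℕ k) → All (_< suc (max xs)) xs
All<1+max []       = []
All<1+max (x ∷ xs) = s≤s (m≤m⊔n x (max xs)) ∷ All<-mono (s≤s (m≤n⊔m x (max xs))) (All<1+max xs)

Refuted-antitone : ∀ {k l θ X n n' s} → n' ≤ n → Refuted k l θ X n s → Refuted k l θ X n' s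
Refuted-antitone n'≤n refuted m m<n' xs xs<n' = refuted m (<-≤-trans m<n' n'≤n) xs (All<-mono n'≤n xs<n')

refutedEverywhere⇔noPrefix : ExcludedMiddle 0ℓ → ∀ {U : Str → Set} k l θ →
  (∀ σ → U σ ⇔ ExistsBlock k (λ xs → ForallBlock l (λ ys → ⟦ θ ⟧ (ys ++ (xs ++ (code σ ∷ [])))))) →
  ∀ X → (∀ n → ∃ (Refuted k l θ X n)) ⇔ (¬ HasPrefixIn X U)
refutedEverywhere⇔noPrefix em {U} k l θ defines X = mk⇔ no-prefix refuted-everywhere
  where
  no-prefix : (∀ n → ∃ (Refuted k l θ X n)) → ¬ HasPrefixIn X U
  no-prefix refuted (m , in-U) =
    let xs , certified = Equivalence.to (defines (X ↾ m)) in-U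
        n = suc (m ⊔ max xs)
        s , refuted-n = refuted n
        ys , _ , ¬θ = refuted-n m (s≤s (m≤m⊔n m (max xs))) xs (All<-mono (s≤s (m≤n⊔m m (max xs))) (All<1+max xs))
    in ¬θ (certified ys)
  refutedBelow-upward : ∀ m xs → Upward (RefutedBelow k l θ X m xs)
  refutedBelow-upward m xs s≤s' (ys , ys<s , ¬θ) = ys , All<-mono s≤s' ys<s , ¬θ
  refutable : ¬ HasPrefixIn X U → ∀ m xs → ∃ (RefutedBelow k l θ X m xs)
  refutable no-prefix m xs with em {∃ λ (ys : Vec ℕ l) → ¬ ⟦ θ ⟧ (ys ++ (xs ++ (code (X ↾ m) ∷ [])))}
  ... | yes (ys , ¬θ) = suc (max ys) , ys , All<1+max ys , ¬θ
  ... | no ∄ys = ⊥-elim (no-prefix (m , Equivalence.from (defines (X ↾ m))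
                   (xs , λ ys → decidable-stable em (λ ¬θ → ∄ys (ys , ¬θ)))))
  refuted-everywhere : ¬ HasPrefixIn X U → ∀ n → ∃ (Refuted k l θ X n)
  refuted-everywhere no-prefix n =
    collect< n (λ m s → ∀ xs → All (_< n) xs → RefutedBelow k l θ X m xs s)
      (λ m s≤s' below xs xs<n → refutedBelow-upward m xs s≤s' (below xs xs<n))
      (λ m _ → collectAll k n (RefutedBelow k l θ X m) (refutedBelow-upward m) (λ xs _ → refutable no-prefix m xs))

lemma3p1 : ExcludedMiddle 0ℓ → (U : Str → Set) → Σ⁰₂ U →
    Σ OracleMachine (λ M → (X : Cantor) →
      (Total M X ⇔ InfiniteDomain M X) × (InfiniteDomain M X ⇔ (¬ HasPrefixIn X U)))
lemma3p1 em U (k , l , θ , defines) = refutationSearch k l θ , λ X →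
  let domain = refutationSearch-domain em k l θ X
      total⇔infinite = total⇔infiniteDomain (Refuted k l θ X) domain Refuted-antitone
      total⇔noPrefix = refutedEverywhere⇔noPrefix em k l θ defines X ⇔-∘ total⇔everywhere (Refuted k l θ X) domain
  in total⇔infinite , total⇔noPrefix ⇔-∘ ⇔-sym total⇔infinite
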